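{- Let $p$ be a prime, $F$ the field with $p$ elements, and $m,n$ positive integers with $p^{n-1}<m\leq p^n$. Let $V$ be an $F$-vector space of dimension $m$, and let $\alpha\in\mathrm{GL}(V)$ be an automorphism whose matrix with respect to some basis of $V$ is the $m\times m$ upper triangular Jordan block with eigenvalue $1$ (ones on the diagonal and on the first superdiagonal, zeros elsewhere). Let $G=\mathrm{Hol}(V,\alpha)$. Then $G$ has order $p^{m+n}$, and the exponent of $G$ is $p^n$ if $m<p^n$ and $p^{n+1}$ if $m=p^n$.
   Context: $V$ is regarded as a group under addition. For a group $K$ and a subgroup $H\le \mathrm{Aut}(K)$, the holomorph $\mathrm{Hol}(K,H)$ is the semidirect product $K\rtimes H$: the group containing copies of $K$ and $H$ as subgroups, with $K$ normal, $K\cap H$ trivial, $\mathrm{Hol}(K,H)=HK$, and $\alpha^{ -1}g\alpha$ equal to the image of $g$ under $\alpha$ for $g\in K$, $\alpha\in H$. $\mathrm{Hol}(K,\alpha)$ means $\mathrm{Hol}(K,\langle\alpha\rangle)$. The exponent of a finite group is the smallest positive integer $e$ with $x^e=1$ for all elements $x$. -}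

module Defs where

open import Data.Nat using (ℕ; zero; suc; _+_; _*_; _≤_; _<_; NonZero; _≡ᵇ_)
open import Data.Nat.DivMod using (_mod_)
open import Data.Fin using (Fin; toℕ)
open import Data.Vec using (Vec; map; zipWith; foldr; replicate; transpose; tabulate)
open import Data.Bool using (if_then_else_; _∨_)
open import Data.Product using (Σ; ∃; ∃-syntax; _×_; _,_; proj₁)
open import Relation.Binary.PropositionalEquality using (_≡_)

module _ (p : ℕ) .{{_ : NonZero p}} (m : ℕ) where

  F : Set
  F = Fin p

  _+F_ : F → F → F
  a +F b = (toℕ a + toℕ b) mod p

  _*F_ : F → F → F
  a *F b = (toℕ a * toℕ b) mod p

  0F 1F : F
  0F = 0 mod p
  1F = 1 mod p

  V : Set
  V = Vec F m

  Mat : Set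
  Mat = Vec (Vec F m) m

  _+V_ : V → V → V
  _+V_ = zipWith _+F_

  0V : V
  0V = replicate m 0F

  dot : V → V → F
  dot u v = foldr (λ _ → F) _+F_ 0F (zipWith _*F_ u v)

  app : Mat → V → V
  app M v = map (λ row → dot row v) M

  _·M_ : Mat → Mat → Mat
  A ·M B = map (λ row → map (λ col → dot row col) (transpose B)) A

  idM : Mat
  idM = tabulate (λ i → tabulate (λ j → if toℕ i ≡ᵇ toℕ j then 1F else 0F))

  jordan : Mat
  jordan = tabulate (λ i → tabulate (λ j →
    if (toℕ j ≡ᵇ toℕ i) ∨ (toℕ j ≡ᵇ suc (toℕ i)) then 1F else 0F))

  matPow : Mat → ℕ → Mat
  matPow A zero = idM
  matPow A (suc k) = matPow A k ·M A

  -- The cyclic subgroup ⟨α⟩ of GL(V) generated by α = jordan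
  -- (a finite group, so nonnegative powers suffice).
  InH : Mat → Set
  InH β = ∃[ k ] β ≡ matPow jordan k

  -- Hol(V, ⟨α⟩) = V ⋊ ⟨α⟩.  An element is a pair (β , v) standing for the
  -- product β·v (β ∈ ⟨α⟩, v ∈ V).  With the convention β⁻¹ v β = β(v):
  --   (β v)(γ w) = (βγ)(γ(v) + w),
  -- where βγ (first β then γ) is the matrix γ·β.
  Raw : Set
  Raw = Mat × V

  _∙_ : Raw → Raw → Raw
  (β , v) ∙ (γ , w) = (γ ·M β , app γ v +V w)

  e : Raw
  e = (idM , 0V)

  _^ᴳ_ : Raw → ℕ → Raw
  x ^ᴳ zero = e
  x ^ᴳ suc k = (x ^ᴳ k) ∙ x

  -- Carrier of G = Hol(V, α); two elements are equal iff their raw data agree.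
  G : Set
  G = Σ Raw (λ x → InH (proj₁ x))

  raw : G → Raw
  raw = proj₁

  HasOrder : ℕ → Set
  HasOrder N = Σ (Fin N → G) λ f →
    (∀ i j → raw (f i) ≡ raw (f j) → i ≡ j) × (∀ x → ∃[ i ] raw (f i) ≡ raw x)

  Kills : ℕ → Set
  Kills k = ∀ (x : G) → raw x ^ᴳ k ≡ e

  HasExponent : ℕ → Set
  HasExponent E = (0 < E) × Kills E × (∀ k → 0 < k → Kills k → E ≤ k)

module Submission where

-- G = V ⋊ ⟨α⟩ with α = 1 + N, where N is the nilpotent shift matrix (N^m = 0). Over 𝔽_p the
-- binomial coefficients (p^e C j) vanish for 0 < j < p^e, so (1 + N)^(p^e) = 1 once m ≤ p^e, whereas
-- entry (0, r) of α^r is (r C r) = 1; hence α has order exactly p^n and |G| = p^n · p^m.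
-- In G, (β, v)^k = (β^k, (1 + β + ⋯ + β^(k-1)) v), and for β = 1 + Z with Z nilpotent the geometric
-- sum equals Σ_j (k C j+1) Z^j, which vanishes for k = p^e > m; so every element dies at p^n when
-- m < p^n. When m = p^n the geometric sum of α over one period has entry (0, m-1) equal to
-- (p^n C p^n) = 1, so (α, e_(m-1)) survives the p^n-th power and the exponent becomes p^(n+1).

open import Algebra.Bundles using (Semiring; CommutativeSemiring)
open import Algebra.Core using (Op₂)
open import Algebra.Structures using (IsCommutativeSemiring)
open import Data.Nat.Base using (ℕ; NonZero)
open import Relation.Binary.PropositionalEquality using (_≡_)

module BinomialDivisibility where

  open import Data.Nat.Base using (ℕ; zero; suc; _+_; _*_; _^_; _<_; NonZero)
  open import Data.Nat.Properties
  open import Data.Nat.Combinatorics using (_C_; nCk+nC[k+1]≡[n+1]C[k+1]; nC1≡n)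
  open import Data.Nat.Divisibility
  open import Data.Nat.Primality using (Prime; euclidsLemma; prime⇒irreducible; prime⇒nonZero)
  open import Data.Nat.Coprimality using (Coprime; coprime-divisor)
  open import Data.Sum.Base using (_⊎_; inj₁; inj₂)
  open import Data.Product.Base using (_,_)
  open import Data.Empty using (⊥-elim)
  open import Relation.Nullary using (¬_; yes; no)
  open import Relation.Binary.PropositionalEquality

  [1+k]*[1+n]C[1+k]≡[1+n]*nCk : ∀ n k → suc k * (suc n C suc k) ≡ suc n * (n C k)
  [1+k]*[1+n]C[1+k]≡[1+n]*nCk zero zero = refl
  [1+k]*[1+n]C[1+k]≡[1+n]*nCk zero (suc k) = *-zeroʳ (suc (suc k))
  [1+k]*[1+n]C[1+k]≡[1+n]*nCk (suc n) zero =
    trans (+-identityʳ _) (trans (nC1≡n (suc (suc n))) (sym (*-identityʳ (suc (suc n)))))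
  [1+k]*[1+n]C[1+k]≡[1+n]*nCk (suc n) (suc k) = begin
    suc (suc k) * (suc (suc n) C suc (suc k))
      ≡⟨ cong (suc (suc k) *_) (pascal (suc n) (suc k)) ⟨
    suc (suc k) * (a + b)
      ≡⟨ *-distribˡ-+ (suc (suc k)) a b ⟩
    (a + suc k * a) + suc (suc k) * b
      ≡⟨ cong₂ (λ x y → (a + x) + y) ([1+k]*[1+n]C[1+k]≡[1+n]*nCk n k) ([1+k]*[1+n]C[1+k]≡[1+n]*nCk n (suc k)) ⟩
    (a + suc n * (n C k)) + suc n * (n C suc k)
      ≡⟨ +-assoc a _ _ ⟩
    a + (suc n * (n C k) + suc n * (n C suc k))
      ≡⟨ cong (a +_) (*-distribˡ-+ (suc n) (n C k) _) ⟨
    a + suc n * (n C k + n C suc k)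
      ≡⟨ cong (λ x → a + suc n * x) (pascal n k) ⟩
    suc (suc n) * a ∎
    where
    open ≡-Reasoning
    pascal : ∀ n k → n C k + n C suc k ≡ suc n C suc k
    pascal = nCk+nC[k+1]≡[n+1]C[k+1]
    a b : ℕ
    a = suc n C suc k
    b = suc n C suc (suc k)

  n∣[1+k]*nC[1+k] : ∀ n k → n ∣ suc k * (n C suc k)
  n∣[1+k]*nC[1+k] zero k = subst (0 ∣_) (sym (*-zeroʳ (suc k))) ∣-refl
  n∣[1+k]*nC[1+k] (suc n) k = divides (n C k) (trans ([1+k]*[1+n]C[1+k]≡[1+n]*nCk n k) (*-comm (suc n) (n C k)))

  module _ {p : ℕ} (p-prime : Prime p) where
    private instance
      p≢0 : NonZero p
      p≢0 = prime⇒nonZero p-prime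

    p^e∣j*c∧p∤c⇒p^e∣j : ∀ e j c → p ^ e ∣ j * c → ¬ p ∣ c → p ^ e ∣ j
    p^e∣j*c∧p∤c⇒p^e∣j zero j c _ _ = 1∣ j
    p^e∣j*c∧p∤c⇒p^e∣j (suc e) j c p^e∣jc p∤c with euclidsLemma j c p-prime (∣-trans (m∣m*n (p ^ e)) p^e∣jc)
    ... | inj₂ p∣c = ⊥-elim (p∤c p∣c)
    ... | inj₁ (divides j′ refl) = subst (p ^ suc e ∣_) (*-comm p j′) (*-monoʳ-∣ p p^e∣j′)
      where
      p^e∣j′ : p ^ e ∣ j′
      p^e∣j′ = p^e∣j*c∧p∤c⇒p^e∣j e j′ c
        (*-cancelˡ-∣ p (subst (p * p ^ e ∣_) (trans (cong (_* c) (*-comm j′ p)) (*-assoc p j′ c)) p^e∣jc))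
        p∤c

    p∣p^eCk : ∀ e k → 0 < k → k < p ^ e → p ∣ (p ^ e) C k
    p∣p^eCk e (suc k) _ k<p^e with p ∣? (p ^ e) C suc k
    ... | yes p∣C = p∣C
    ... | no p∤C = ⊥-elim (<⇒≱ k<p^e (∣⇒≤ (p^e∣j*c∧p∤c⇒p^e∣j e (suc k) _ (n∣[1+k]*nC[1+k] (p ^ e) k) p∤C)))

    p∤d⇒coprime : ∀ {d} → ¬ p ∣ d → Coprime d p
    p∤d⇒coprime p∤d (c∣d , c∣p) with prime⇒irreducible p-prime c∣p
    ... | inj₁ c≡1 = c≡1
    ... | inj₂ refl = ⊥-elim (p∤d c∣d)

    ∣p^[1+n]⇒≡p^[1+n]⊎∣p^n : ∀ n {d} → d ∣ p ^ suc n → d ≡ p ^ suc n ⊎ d ∣ p ^ n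
    ∣p^[1+n]⇒≡p^[1+n]⊎∣p^n n {d} d∣ with p ∣? d
    ... | no p∤d = inj₂ (coprime-divisor (p∤d⇒coprime p∤d) d∣)
    ∣p^[1+n]⇒≡p^[1+n]⊎∣p^n zero d∣ | yes (divides d′ refl) =
      inj₁ (trans (cong (_* p) (∣1⇒≡1 (*-cancelʳ-∣ {d′} p (subst (d′ * p ∣_) (*-comm p 1) d∣)))) (*-comm 1 p))
    ∣p^[1+n]⇒≡p^[1+n]⊎∣p^n (suc n) d∣ | yes (divides d′ refl)
      with ∣p^[1+n]⇒≡p^[1+n]⊎∣p^n n (*-cancelʳ-∣ {d′} p (subst (d′ * p ∣_) (*-comm p (p ^ suc n)) d∣))
    ... | inj₁ d′≡ = inj₁ (trans (cong (_* p) d′≡) (*-comm (p ^ suc n) p))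
    ... | inj₂ d′∣ = inj₂ (subst (d′ * p ∣_) (*-comm (p ^ n) p) (*-monoˡ-∣ p d′∣))

module SemiringPowers {a ℓ} (S : Semiring a ℓ) where

  open import Data.Nat.Base as ℕ using (ℕ; zero; suc; _<_; _≤_; s≤s; z≤n)
  import Data.Nat.Properties as ℕ
  open import Data.Nat.Combinatorics using (_C_; nCk+nC[k+1]≡[n+1]C[k+1])
  open import Data.Nat.Divisibility using (_∣_; divides)
  open import Data.Nat.DivMod using (m≡m%n+[m/n]*n)
  open import Data.Nat.GCD using (gcd; gcd-GCD; gcd[m,n]∣m; gcd[m,n]∣n; module Bézout)
  open import Data.Nat.Primality using (Prime)
  open import Data.Fin.Base using (toℕ)
  open import Data.Fin.Properties using (toℕ<n)
  open import Data.Sum.Base using (inj₁; inj₂)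
  open import Data.Empty using (⊥-elim)
  open import Relation.Nullary using (¬_)
  open import Relation.Binary.PropositionalEquality as ≡ using (_≡_)
  open BinomialDivisibility using (p∣p^eCk; ∣p^[1+n]⇒≡p^[1+n]⊎∣p^n)

  open Semiring S
  open import Algebra.Properties.Semiring.Exp S public using (_^_)
  open import Algebra.Properties.Semiring.Exp S using (^-homo-*; ^-assocʳ; ^-congˡ)
  open import Algebra.Properties.Semiring.Mult S public using (_×_)
  open import Algebra.Properties.Semiring.Mult S using (×-homo-+; ×-assoc-*; ×-comm-*; ×-congʳ; ×-assocˡ)
  open import Algebra.Properties.Semiring.Sum S public using (sum)
  open import Algebra.Properties.Semiring.Sum S using (∑-distrib-+; *-distribˡ-sum; sum-cong-≋; sum-replicate-zero)
  open import Relation.Binary.Reasoning.Setoid setoid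

  Commute : Carrier → Carrier → Set ℓ
  Commute x y = x * y ≈ y * x

  commute-+ : ∀ {x y z} → Commute x y → Commute x z → Commute x (y + z)
  commute-+ {x} {y} {z} xy xz = begin
    x * (y + z)      ≈⟨ distribˡ x y z ⟩
    x * y + x * z    ≈⟨ +-cong xy xz ⟩
    y * x + z * x    ≈⟨ distribʳ x y z ⟨
    (y + z) * x      ∎

  commute-* : ∀ {x y z} → Commute x y → Commute x z → Commute x (y * z)
  commute-* {x} {y} {z} xy xz = begin
    x * (y * z)      ≈⟨ *-assoc x y z ⟨
    x * y * z        ≈⟨ *-congʳ xy ⟩
    y * x * z        ≈⟨ *-assoc y x z ⟩
    y * (x * z)      ≈⟨ *-congˡ xz ⟩
    y * (z * x)      ≈⟨ *-assoc y z x ⟨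
    y * z * x        ∎

  commute-1 : ∀ x → Commute x 1#
  commute-1 x = trans (*-identityʳ x) (sym (*-identityˡ x))

  commute-0 : ∀ x → Commute x 0#
  commute-0 x = trans (zeroʳ x) (sym (zeroˡ x))

  commute-^ : ∀ {x y} k → Commute x y → Commute x (y ^ k)
  commute-^ {x} zero _ = commute-1 x
  commute-^ (suc k) xy = commute-* xy (commute-^ k xy)

  ^-suc : ∀ x k → x ^ k * x ≈ x ^ suc k
  ^-suc x k = sym (commute-^ k refl)

  ^-distrib-* : ∀ {x y} k → Commute x y → (x * y) ^ k ≈ x ^ k * y ^ k
  ^-distrib-* zero _ = sym (*-identityˡ 1#)
  ^-distrib-* {x} {y} (suc k) xy = begin
    x * y * (x * y) ^ k          ≈⟨ *-congˡ (^-distrib-* k xy) ⟩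
    x * y * (x ^ k * y ^ k)      ≈⟨ *-assoc x y _ ⟩
    x * (y * (x ^ k * y ^ k))    ≈⟨ *-congˡ (*-assoc y (x ^ k) (y ^ k)) ⟨
    x * (y * x ^ k * y ^ k)      ≈⟨ *-congˡ (*-congʳ (commute-^ k (sym xy))) ⟩
    x * (x ^ k * y * y ^ k)      ≈⟨ *-congˡ (*-assoc (x ^ k) y (y ^ k)) ⟩
    x * (x ^ k * (y * y ^ k))    ≈⟨ *-assoc x (x ^ k) _ ⟨
    x * x ^ k * (y * y ^ k)      ∎

  geom : Carrier → ℕ → Carrier
  geom x zero = 0#
  geom x (suc k) = x * geom x k + 1#

  commute-geom : ∀ {x y} k → Commute x y → Commute x (geom y k)
  commute-geom {x} zero _ = commute-0 x
  commute-geom {x} (suc k) xy = commute-+ (commute-* xy (commute-geom k xy)) (commute-1 x)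

  geom-+ : ∀ x a b → geom x (a ℕ.+ b) ≈ geom x a + x ^ a * geom x b
  geom-+ x zero b = sym (trans (+-identityˡ _) (*-identityˡ _))
  geom-+ x (suc a) b = begin
    x * geom x (a ℕ.+ b) + 1#                          ≈⟨ +-congʳ (*-congˡ (geom-+ x a b)) ⟩
    x * (geom x a + x ^ a * geom x b) + 1#              ≈⟨ +-congʳ (distribˡ x _ _) ⟩
    x * geom x a + x * (x ^ a * geom x b) + 1#          ≈⟨ +-assoc _ _ 1# ⟩
    x * geom x a + (x * (x ^ a * geom x b) + 1#)        ≈⟨ +-congˡ (+-comm _ 1#) ⟩
    x * geom x a + (1# + x * (x ^ a * geom x b))        ≈⟨ +-assoc _ 1# _ ⟨
    x * geom x a + 1# + x * (x ^ a * geom x b)          ≈⟨ +-congˡ (*-assoc x (x ^ a) _) ⟨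
    geom x (suc a) + x ^ suc a * geom x b               ∎

  geom-*-period : ∀ {x q} → x ^ q ≈ 1# → ∀ t → geom x (t ℕ.* q) ≈ t × geom x q
  geom-*-period _ zero = refl
  geom-*-period {x} {q} x^q≈1 (suc t) = begin
    geom x (q ℕ.+ t ℕ.* q)                  ≈⟨ geom-+ x q (t ℕ.* q) ⟩
    geom x q + x ^ q * geom x (t ℕ.* q)     ≈⟨ +-congˡ (*-cong x^q≈1 (geom-*-period x^q≈1 t)) ⟩
    geom x q + 1# * t × geom x q            ≈⟨ +-congˡ (*-identityˡ _) ⟩
    suc t × geom x q                        ∎

  [1+z]^k≈1+z*geom[1+z]k : ∀ z k → (1# + z) ^ k ≈ 1# + z * geom (1# + z) k
  [1+z]^k≈1+z*geom[1+z]k z zero = sym (trans (+-congˡ (zeroʳ z)) (+-identityʳ 1#))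
  [1+z]^k≈1+z*geom[1+z]k z (suc k) = begin
    (1# + z) * (1# + z) ^ k                        ≈⟨ *-congˡ ([1+z]^k≈1+z*geom[1+z]k z k) ⟩
    (1# + z) * (1# + g)                            ≈⟨ distribʳ (1# + g) 1# z ⟩
    1# * (1# + g) + z * (1# + g)                   ≈⟨ +-cong (*-identityˡ _) (distribˡ z 1# g) ⟩
    1# + g + (z * 1# + z * g)                      ≈⟨ +-assoc 1# g _ ⟩
    1# + (g + (z * 1# + z * g))                    ≈⟨ +-congˡ (+-congˡ (+-comm _ _)) ⟩
    1# + (g + (z * g + z * 1#))                    ≈⟨ +-congˡ (+-assoc g _ _) ⟨
    1# + (g + z * g + z * 1#)                      ≈⟨ +-congˡ (+-congʳ (+-congʳ (*-identityˡ g))) ⟨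
    1# + (1# * g + z * g + z * 1#)                 ≈⟨ +-congˡ (+-congʳ (distribʳ g 1# z)) ⟨
    1# + ((1# + z) * g + z * 1#)                   ≈⟨ +-congˡ (+-congʳ (*-assoc (1# + z) z _)) ⟨
    1# + ((1# + z) * z * geom (1# + z) k + z * 1#) ≈⟨ +-congˡ (+-congʳ (*-congʳ (commute-+ (commute-1 z) refl))) ⟨
    1# + (z * (1# + z) * geom (1# + z) k + z * 1#) ≈⟨ +-congˡ (+-congʳ (*-assoc z (1# + z) _)) ⟩
    1# + (z * ((1# + z) * geom (1# + z) k) + z * 1#) ≈⟨ +-congˡ (distribˡ z _ 1#) ⟨
    1# + z * geom (1# + z) (suc k)                 ∎
    where
    g : Carrier
    g = z * geom (1# + z) k

  ×≈×1* : ∀ n x → n × x ≈ (n × 1#) * x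
  ×≈×1* n x = sym (trans (×-assoc-* n 1# x) (×-congʳ n (*-identityˡ x)))

  p∣n⇒n×x≈0 : ∀ {p n} x → p × 1# ≈ 0# → p ∣ n → n × x ≈ 0#
  p∣n⇒n×x≈0 {p} x p×1≈0 (divides q ≡.refl) = begin
    (q ℕ.* p) × x          ≈⟨ ×-assocˡ x q p ⟨
    q × (p × x)            ≈⟨ ×-congʳ q (×≈×1* p x) ⟩
    q × ((p × 1#) * x)     ≈⟨ ×-congʳ q (trans (*-congʳ p×1≈0) (zeroˡ x)) ⟩
    q × 0#                 ≈⟨ ×≈×1* q 0# ⟩
    (q × 1#) * 0#          ≈⟨ zeroʳ _ ⟩
    0#                     ∎

  ∑< : ℕ → (ℕ → Carrier) → Carrier
  ∑< L f = sum {L} (λ j → f (toℕ j))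

  ∑<-cong : ∀ L {f g} → (∀ j → j < L → f j ≈ g j) → ∑< L f ≈ ∑< L g
  ∑<-cong L eq = sum-cong-≋ (λ j → eq (toℕ j) (toℕ<n j))

  ∑<-snoc : ∀ L f → ∑< (suc L) f ≈ ∑< L f + f L
  ∑<-snoc zero f = trans (+-identityʳ (f 0)) (sym (+-identityˡ (f 0)))
  ∑<-snoc (suc L) f = begin
    f 0 + ∑< (suc L) (λ j → f (suc j))        ≈⟨ +-congˡ (∑<-snoc L (λ j → f (suc j))) ⟩
    f 0 + (∑< L (λ j → f (suc j)) + f (suc L)) ≈⟨ +-assoc _ _ _ ⟨
    ∑< (suc L) f + f (suc L)                    ∎

  ∑<-zero : ∀ L f → (∀ j → j < L → f j ≈ 0#) → ∑< L f ≈ 0#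
  ∑<-zero L f eq = trans (∑<-cong L eq) (sum-replicate-zero L)

  module Unipotent (z : Carrier) (d : ℕ) (z^d≈0 : z ^ d ≈ 0#) where

    -- Truncating at d loses nothing, since z ^ d ≈ 0.
    poly : (ℕ → ℕ) → Carrier
    poly c = ∑< d (λ j → c j × z ^ j)

    shift : (ℕ → ℕ) → ℕ → ℕ
    shift c zero = 0
    shift c (suc j) = c j

    poly-cong : ∀ c c′ → (∀ j → j < d → c j × 1# ≈ c′ j × 1#) → poly c ≈ poly c′
    poly-cong c c′ eq = ∑<-cong d λ j j<d → begin
      c j × z ^ j             ≈⟨ ×≈×1* (c j) _ ⟩
      (c j × 1#) * z ^ j      ≈⟨ *-congʳ (eq j j<d) ⟩
      (c′ j × 1#) * z ^ j     ≈⟨ ×≈×1* (c′ j) _ ⟨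
      c′ j × z ^ j            ∎

    poly-+ : ∀ c c′ → poly c + poly c′ ≈ poly (λ j → c j ℕ.+ c′ j)
    poly-+ c c′ = trans (sym (∑-distrib-+ {d} (λ j → c (toℕ j) × z ^ toℕ j) _))
                        (∑<-cong d (λ j _ → sym (×-homo-+ (z ^ j) (c j) (c′ j))))

    z*poly≈poly-shift : ∀ c → z * poly c ≈ poly (shift c)
    z*poly≈poly-shift c = begin
      z * poly c
        ≈⟨ *-distribˡ-sum {d} z (λ j → c (toℕ j) × z ^ toℕ j) ⟩
      ∑< d (λ j → z * (c j × z ^ j))
        ≈⟨ ∑<-cong d (λ j _ → ×-comm-* (c j) z (z ^ j)) ⟩
      ∑< d (λ j → c j × z ^ suc j)
        ≈⟨ +-identityˡ _ ⟨
      ∑< (suc d) (λ j → shift c j × z ^ j)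
        ≈⟨ ∑<-snoc d (λ j → shift c j × z ^ j) ⟩
      poly (shift c) + shift c d × z ^ d
        ≈⟨ +-congˡ (trans (×-congʳ (shift c d) z^d≈0) (trans (×≈×1* (shift c d) 0#) (zeroʳ _))) ⟩
      poly (shift c) + 0#
        ≈⟨ +-identityʳ _ ⟩
      poly (shift c) ∎

    poly-0 : poly (λ _ → 0) ≈ 0#
    poly-0 = ∑<-zero d _ (λ _ _ → refl)

    poly-1 : 0 < d → poly (0 C_) ≈ 1#
    poly-1 = helper d
      where
      helper : ∀ L → 0 < L → ∑< L (λ j → (0 C j) × z ^ j) ≈ 1#
      helper (suc L) _ = trans (+-congˡ (∑<-zero L _ (λ _ _ → refl))) (trans (+-identityʳ _) (+-identityʳ 1#))

    poly-congℕ : ∀ c c′ → (∀ j → c j ≡ c′ j) → poly c ≈ poly c′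
    poly-congℕ c c′ eq = poly-cong c c′ (λ j _ → reflexive (≡.cong (_× 1#) (eq j)))

    [1+z]*poly : ∀ c → (1# + z) * poly c ≈ poly (λ j → c j ℕ.+ shift c j)
    [1+z]*poly c = begin
      (1# + z) * poly c                 ≈⟨ distribʳ (poly c) 1# z ⟩
      1# * poly c + z * poly c          ≈⟨ +-cong (*-identityˡ (poly c)) (z*poly≈poly-shift c) ⟩
      poly c + poly (shift c)           ≈⟨ poly-+ c (shift c) ⟩
      poly (λ j → c j ℕ.+ shift c j)    ∎

    [1+z]^k≈poly[kC] : 0 < d → ∀ k → (1# + z) ^ k ≈ poly (k C_)
    [1+z]^k≈poly[kC] 0<d zero = sym (poly-1 0<d)
    [1+z]^k≈poly[kC] 0<d (suc k) = begin
      (1# + z) * (1# + z) ^ k                 ≈⟨ *-congˡ ([1+z]^k≈poly[kC] 0<d k) ⟩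
      (1# + z) * poly (k C_)                  ≈⟨ [1+z]*poly (k C_) ⟩
      poly (λ j → k C j ℕ.+ shift (k C_) j)   ≈⟨ poly-congℕ (λ j → k C j ℕ.+ shift (k C_) j) (suc k C_) pascal ⟩
      poly (suc k C_)                         ∎
      where
      pascal : ∀ j → k C j ℕ.+ shift (k C_) j ≡ suc k C j
      pascal zero = ≡.refl
      pascal (suc j) = ≡.trans (ℕ.+-comm (k C suc j) (k C j)) (nCk+nC[k+1]≡[n+1]C[k+1] k j)

    geom[1+z]k≈poly[kC[1+_]] : 0 < d → ∀ k → geom (1# + z) k ≈ poly (λ j → k C suc j)
    geom[1+z]k≈poly[kC[1+_]] 0<d zero = sym poly-0
    geom[1+z]k≈poly[kC[1+_]] 0<d (suc k) = begin
      (1# + z) * geom (1# + z) k + 1#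
        ≈⟨ +-cong (*-congˡ (geom[1+z]k≈poly[kC[1+_]] 0<d k)) (sym (poly-1 0<d)) ⟩
      (1# + z) * poly c + poly (0 C_)
        ≈⟨ +-congʳ ([1+z]*poly c) ⟩
      poly (λ j → c j ℕ.+ shift c j) + poly (0 C_)
        ≈⟨ poly-+ (λ j → c j ℕ.+ shift c j) (0 C_) ⟩
      poly (λ j → c j ℕ.+ shift c j ℕ.+ 0 C j)
        ≈⟨ poly-congℕ (λ j → c j ℕ.+ shift c j ℕ.+ 0 C j) (λ j → suc k C suc j) pascal ⟩
      poly (λ j → suc k C suc j) ∎
      where
      c : ℕ → ℕ
      c j = k C suc j
      pascal : ∀ j → c j ℕ.+ shift c j ℕ.+ 0 C j ≡ suc k C suc j
      pascal zero = ≡.trans (ℕ.+-comm (k C 1 ℕ.+ 0) 1)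
        (≡.trans (≡.cong suc (ℕ.+-identityʳ (k C 1))) (nCk+nC[k+1]≡[n+1]C[k+1] k 0))
      pascal (suc j) = ≡.trans (ℕ.+-identityʳ _) (≡.trans (ℕ.+-comm (k C suc (suc j)) (k C suc j))
                                                          (nCk+nC[k+1]≡[n+1]C[k+1] k (suc j)))

    module _ {p} (p-prime : Prime p) (p×1≈0 : p × 1# ≈ 0#) (0<d : 0 < d) where

      [1+z]^p^e≈1 : ∀ e → d ≤ p ℕ.^ e → (1# + z) ^ (p ℕ.^ e) ≈ 1#
      [1+z]^p^e≈1 e d≤p^e = begin
        (1# + z) ^ (p ℕ.^ e)     ≈⟨ [1+z]^k≈poly[kC] 0<d (p ℕ.^ e) ⟩
        poly ((p ℕ.^ e) C_)      ≈⟨ poly-cong ((p ℕ.^ e) C_) (0 C_) coefficients ⟩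
        poly (0 C_)            ≈⟨ poly-1 0<d ⟩
        1#                     ∎
        where
        coefficients : ∀ j → j < d → ((p ℕ.^ e) C j) × 1# ≈ (0 C j) × 1#
        coefficients zero _ = refl
        coefficients (suc j) j<d = p∣n⇒n×x≈0 1# p×1≈0 (p∣p^eCk p-prime e (suc j) (s≤s z≤n) (ℕ.<-≤-trans j<d d≤p^e))

      geom[1+z]p^e≈0 : ∀ e → d < p ℕ.^ e → geom (1# + z) (p ℕ.^ e) ≈ 0#
      geom[1+z]p^e≈0 e d<p^e = begin
        geom (1# + z) (p ℕ.^ e)           ≈⟨ geom[1+z]k≈poly[kC[1+_]] 0<d (p ℕ.^ e) ⟩
        poly (λ j → (p ℕ.^ e) C suc j)    ≈⟨ poly-cong (λ j → (p ℕ.^ e) C suc j) (λ _ → 0) coefficients ⟩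
        poly (λ _ → 0)                  ≈⟨ poly-0 ⟩
        0#                              ∎
        where
        coefficients : ∀ j → j < d → ((p ℕ.^ e) C suc j) × 1# ≈ 0 × 1#
        coefficients j j<d = p∣n⇒n×x≈0 1# p×1≈0 (p∣p^eCk p-prime e (suc j) (s≤s z≤n) (ℕ.≤-<-trans j<d d<p^e))

  1^k≈1 : ∀ k → 1# ^ k ≈ 1#
  1^k≈1 zero = refl
  1^k≈1 (suc k) = trans (*-identityˡ _) (1^k≈1 k)

  ^-*-≈1 : ∀ {x q} → x ^ q ≈ 1# → ∀ t → x ^ (t ℕ.* q) ≈ 1#
  ^-*-≈1 {x} {q} x^q≈1 t = begin
    x ^ (t ℕ.* q)      ≡⟨ ≡.cong (x ^_) (ℕ.*-comm t q) ⟩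
    x ^ (q ℕ.* t)      ≈⟨ ^-assocʳ x q t ⟨
    (x ^ q) ^ t        ≈⟨ ^-congˡ t x^q≈1 ⟩
    1# ^ t             ≈⟨ 1^k≈1 t ⟩
    1#                 ∎

  ^-cancel : ∀ {x} a {b} → x ^ b ≈ 1# → x ^ (a ℕ.+ b) ≈ 1# → x ^ a ≈ 1#
  ^-cancel {x} a {b} x^b≈1 x^[a+b]≈1 = begin
    x ^ a              ≈⟨ *-identityʳ _ ⟨
    x ^ a * 1#         ≈⟨ *-congˡ x^b≈1 ⟨
    x ^ a * x ^ b      ≈⟨ ^-homo-* x a b ⟨
    x ^ (a ℕ.+ b)      ≈⟨ x^[a+b]≈1 ⟩
    1#                 ∎

  ^-gcd : ∀ {x a b} → x ^ a ≈ 1# → x ^ b ≈ 1# → x ^ gcd a b ≈ 1#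
  ^-gcd {x} {a} {b} x^a≈1 x^b≈1 with Bézout.identity (gcd-GCD a b)
  ... | Bézout.+- s t eq = ^-cancel (gcd a b) (^-*-≈1 x^b≈1 t) (trans (reflexive (≡.cong (x ^_) eq)) (^-*-≈1 x^a≈1 s))
  ... | Bézout.-+ s t eq = ^-cancel (gcd a b) (^-*-≈1 x^a≈1 s) (trans (reflexive (≡.cong (x ^_) eq)) (^-*-≈1 x^b≈1 t))

  ^≈1⇒p^[1+n]∣ : ∀ {p x} n → Prime p → x ^ (p ℕ.^ suc n) ≈ 1# → ¬ x ^ (p ℕ.^ n) ≈ 1# →
                      ∀ k → x ^ k ≈ 1# → p ℕ.^ suc n ∣ k
  ^≈1⇒p^[1+n]∣ {p} {x} n p-prime x^p^[1+n]≈1 x^p^n≉1 k x^k≈1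
    with ∣p^[1+n]⇒≡p^[1+n]⊎∣p^n p-prime n (gcd[m,n]∣n k (p ℕ.^ suc n))
  ... | inj₁ g≡p^[1+n] = ≡.subst (_∣ k) g≡p^[1+n] (gcd[m,n]∣m k (p ℕ.^ suc n))
  ... | inj₂ (divides t p^n≡t*g) =
    ⊥-elim (x^p^n≉1 (trans (reflexive (≡.cong (x ^_) p^n≡t*g)) (^-*-≈1 (^-gcd {x} {k} {p ℕ.^ suc n} x^k≈1 x^p^[1+n]≈1) t)))

  ^-injective : ∀ {x q} → (∀ k → x ^ k ≈ 1# → q ∣ k) → x ^ q ≈ 1# →
                ∀ {a b} → a < q → b < q → x ^ a ≈ x ^ b → a ≡ b
  ^-injective {x} {q} order x^q≈1 {a} {b} a<q b<q x^a≈x^b = ≡.sym (ℕ.+-cancelˡ-≡ (q ℕ.∸ a) b a r≡q-a+a)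
    where
    r : ℕ
    r = q ℕ.∸ a ℕ.+ b
    q-a+a≡q : q ℕ.∸ a ℕ.+ a ≡ q
    q-a+a≡q = ℕ.m∸n+n≡m (ℕ.<⇒≤ a<q)
    x^r≈1 : x ^ r ≈ 1#
    x^r≈1 = begin
      x ^ (q ℕ.∸ a ℕ.+ b)            ≈⟨ ^-homo-* x (q ℕ.∸ a) b ⟩
      x ^ (q ℕ.∸ a) * x ^ b          ≈⟨ *-congˡ x^a≈x^b ⟨
      x ^ (q ℕ.∸ a) * x ^ a          ≈⟨ ^-homo-* x (q ℕ.∸ a) a ⟨
      x ^ (q ℕ.∸ a ℕ.+ a)            ≡⟨ ≡.cong (x ^_) q-a+a≡q ⟩
      x ^ q                          ≈⟨ x^q≈1 ⟩
      1#                             ∎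
    r≡q : r ≡ q
    r≡q with order r x^r≈1
    ... | divides zero r≡0 = ⊥-elim (ℕ.<⇒≢ (ℕ.<-≤-trans (ℕ.m<n⇒0<n∸m a<q) (ℕ.m≤m+n (q ℕ.∸ a) b)) (≡.sym r≡0))
    ... | divides (suc zero) r≡q = ≡.trans r≡q (ℕ.+-identityʳ q)
    ... | divides (suc (suc t)) r≡[2+t]q =
      ⊥-elim (ℕ.<⇒≱ (ℕ.+-mono-≤-< (ℕ.m∸n≤m q a) b<q)
                    (≡.subst (q ℕ.+ q ℕ.≤_) (≡.sym r≡[2+t]q) (ℕ.+-monoʳ-≤ q (ℕ.m≤m+n q (t ℕ.* q)))))
    r≡q-a+a : q ℕ.∸ a ℕ.+ b ≡ q ℕ.∸ a ℕ.+ a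
    r≡q-a+a = ≡.trans r≡q (≡.sym q-a+a≡q)

  ^-mod : ∀ {x} q .{{_ : ℕ.NonZero q}} → x ^ q ≈ 1# → ∀ k → x ^ k ≈ x ^ (k ℕ.% q)
  ^-mod {x} q x^q≈1 k = begin
    x ^ k                                    ≡⟨ ≡.cong (x ^_) (m≡m%n+[m/n]*n k q) ⟩
    x ^ (k ℕ.% q ℕ.+ k ℕ./ q ℕ.* q)           ≈⟨ ^-homo-* x (k ℕ.% q) _ ⟩
    x ^ (k ℕ.% q) * x ^ (k ℕ./ q ℕ.* q)       ≈⟨ *-congˡ (^-*-≈1 x^q≈1 (k ℕ./ q)) ⟩
    x ^ (k ℕ.% q) * 1#                       ≈⟨ *-identityʳ _ ⟩
    x ^ (k ℕ.% q)                            ∎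

module SquareMatrices {A : Set} {_+′_ _*′_ : Op₂ A} {0′ 1′ : A}
  (isCommutativeSemiring : IsCommutativeSemiring _≡_ _+′_ _*′_ 0′ 1′) (m : ℕ) where

  -- Matrix product, identity, matrix–vector action and the Jordan block are spelled exactly as in
  -- Defs, so over F p m they coincide definitionally with _·M_, idM, app, _+V_, 0V and jordan.

  open import Algebra.Structures using (IsSemiring)
  open import Algebra.Structures.Biased using (isCommutativeMonoidˡ)
  open import Data.Bool.Base using (true; false; if_then_else_; _∨_)
  open import Data.Empty using (⊥-elim)
  open import Data.Fin.Base using (Fin; zero; suc; toℕ; fromℕ<)
  open import Data.Fin.Properties using (toℕ-injective; suc-injective; toℕ-fromℕ<; toℕ<n)
  open import Data.Nat.Base as ℕ using (zero; suc; _≡ᵇ_; _<_)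
  import Data.Nat.Properties as ℕ
  open import Data.Product.Base using (_,_)
  open import Data.Vec.Base using (Vec; []; _∷_; lookup; tabulate; map; zipWith; foldr; replicate; transpose; _⊛_)
  import Data.Vec.Properties as Vec
  open import Function.Base using (_∘_)
  open import Level using (0ℓ)
  open import Relation.Binary.PropositionalEquality
  open import Relation.Nullary using (yes; no)

  ≡ᵇ-true : ∀ {a b} → a ≡ b → (a ≡ᵇ b) ≡ true
  ≡ᵇ-true {a} {b} a≡b with a ≡ᵇ b | ℕ.≡⇒≡ᵇ a b a≡b
  ... | true | _ = refl

  ≡ᵇ-false : ∀ {a b} → a ≢ b → (a ≡ᵇ b) ≡ false
  ≡ᵇ-false {a} {b} a≢b with a ≡ᵇ b | ℕ.≡ᵇ⇒≡ a b
  ... | false | _ = refl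
  ... | true | a≡b = ⊥-elim (a≢b (a≡b _))

  lookup-transpose : ∀ {B : Set} {r c} (M : Vec (Vec B c) r) (j : Fin c) →
    lookup (transpose M) j ≡ map (λ row → lookup row j) M
  lookup-transpose {c = c} [] j = Vec.lookup-replicate j []
  lookup-transpose {c = c} (row ∷ rows) j = begin
    lookup ((replicate c _∷_ ⊛ row) ⊛ transpose rows) j
      ≡⟨ Vec.lookup-⊛ j (replicate c _∷_ ⊛ row) (transpose rows) ⟩
    lookup (replicate c _∷_ ⊛ row) j (lookup (transpose rows) j)
      ≡⟨ cong (λ f → f (lookup (transpose rows) j)) (Vec.lookup-⊛ j (replicate c _∷_) row) ⟩
    lookup (replicate c _∷_) j (lookup row j) (lookup (transpose rows) j)
      ≡⟨ cong (λ f → f (lookup row j) (lookup (transpose rows) j)) (Vec.lookup-replicate j _∷_) ⟩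
    lookup row j ∷ lookup (transpose rows) j
      ≡⟨ cong (lookup row j ∷_) (lookup-transpose rows j) ⟩
    lookup row j ∷ map (λ row → lookup row j) rows ∎
    where open ≡-Reasoning

  vec-ext : ∀ {B : Set} {n} {u v : Vec B n} → (∀ i → lookup u i ≡ lookup v i) → u ≡ v
  vec-ext {u = u} {v} eq = trans (sym (Vec.tabulate∘lookup u)) (trans (Vec.tabulate-cong eq) (Vec.tabulate∘lookup v))


  R : CommutativeSemiring 0ℓ 0ℓ
  R = record { isCommutativeSemiring = isCommutativeSemiring }

  open CommutativeSemiring R using (_+_; _*_; 0#; 1#; +-assoc; +-comm; +-identityˡ; +-identityʳ; *-assoc; *-comm;
    *-identityˡ; *-identityʳ; zeroˡ; zeroʳ; distribˡ; distribʳ; semiring)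
  open import Algebra.Properties.Semiring.Sum semiring
    using (sum; sum-cong-≋; sum-replicate-zero; ∑-distrib-+; ∑-comm; *-distribˡ-sum; *-distribʳ-sum)

  sum-zero : ∀ {n} (f : Fin n → A) → (∀ k → f k ≡ 0#) → sum f ≡ 0#
  sum-zero {n} f eq = trans (sum-cong-≋ eq) (sum-replicate-zero n)

  sum-δ : ∀ {n} (f : Fin n → A) i → (∀ k → k ≢ i → f k ≡ 0#) → sum f ≡ f i
  sum-δ {suc n} f zero eq =
    trans (cong (f zero +_) (sum-zero _ (λ k → eq (suc k) (λ ())))) (+-identityʳ (f zero))
  sum-δ {suc n} f (suc i) eq =
    trans (cong₂ _+_ (eq zero (λ ())) (sum-δ (λ k → f (suc k)) i (λ k k≢i → eq (suc k) (k≢i ∘ suc-injective))))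
          (+-identityˡ _)

  Mat : Set
  Mat = Vec (Vec A m) m

  entry : Mat → Fin m → Fin m → A
  entry M i j = lookup (lookup M i) j

  matrix : (Fin m → Fin m → A) → Mat
  matrix f = tabulate (λ i → tabulate (f i))

  entry-matrix : ∀ f i j → entry (matrix f) i j ≡ f i j
  entry-matrix f i j = trans (cong (λ row → lookup row j) (Vec.lookup∘tabulate _ i)) (Vec.lookup∘tabulate _ j)

  matrix-ext : ∀ {M N} → (∀ i j → entry M i j ≡ entry N i j) → M ≡ N
  matrix-ext eq = vec-ext (λ i → vec-ext (eq i))

  dot : ∀ {n} → Vec A n → Vec A n → A
  dot u v = foldr (λ _ → A) _+_ 0# (zipWith _*_ u v)

  dot≡sum : ∀ {n} (u v : Vec A n) → dot u v ≡ sum (λ k → lookup u k * lookup v k)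
  dot≡sum [] [] = refl
  dot≡sum (a ∷ u) (b ∷ v) = cong (a * b +_) (dot≡sum u v)

  infixl 6 _+ᴹ_
  infixl 7 _*ᴹ_

  _+ᴹ_ : Mat → Mat → Mat
  M +ᴹ N = matrix (λ i j → entry M i j + entry N i j)

  _*ᴹ_ : Mat → Mat → Mat
  M *ᴹ N = map (λ row → map (λ col → dot row col) (transpose N)) M

  0ᴹ : Mat
  0ᴹ = matrix (λ _ _ → 0#)

  δ : ℕ → ℕ → A
  δ a b = if a ≡ᵇ b then 1# else 0#

  δ-≡ : ∀ {a b} → a ≡ b → δ a b ≡ 1#
  δ-≡ a≡b = cong (if_then 1# else 0#) (≡ᵇ-true a≡b)

  δ-≢ : ∀ {a b} → a ≢ b → δ a b ≡ 0#
  δ-≢ a≢b = cong (if_then 1# else 0#) (≡ᵇ-false a≢b)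

  1ᴹ : Mat
  1ᴹ = matrix (λ i j → δ (toℕ i) (toℕ j))

  entry-+ᴹ : ∀ M N i j → entry (M +ᴹ N) i j ≡ entry M i j + entry N i j
  entry-+ᴹ M N = entry-matrix _

  entry-0ᴹ : ∀ i j → entry 0ᴹ i j ≡ 0#
  entry-0ᴹ = entry-matrix _

  entry-1ᴹ-diag : ∀ i → entry 1ᴹ i i ≡ 1#
  entry-1ᴹ-diag i = trans (entry-matrix _ i i) (δ-≡ {toℕ i} refl)

  entry-1ᴹ-off : ∀ {i j} → i ≢ j → entry 1ᴹ i j ≡ 0#
  entry-1ᴹ-off {i} {j} i≢j = trans (entry-matrix _ i j) (δ-≢ (i≢j ∘ toℕ-injective))

  entry-*ᴹ : ∀ M N i j → entry (M *ᴹ N) i j ≡ sum (λ k → entry M i k * entry N k j)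
  entry-*ᴹ M N i j = begin
    entry (M *ᴹ N) i j
      ≡⟨ cong (λ row → lookup row j) (Vec.lookup-map i _ M) ⟩
    lookup (map (dot (lookup M i)) (transpose N)) j
      ≡⟨ Vec.lookup-map j _ (transpose N) ⟩
    dot (lookup M i) (lookup (transpose N) j)
      ≡⟨ cong (dot (lookup M i)) (lookup-transpose N j) ⟩
    dot (lookup M i) (map (λ row → lookup row j) N)
      ≡⟨ dot≡sum (lookup M i) _ ⟩
    sum (λ k → entry M i k * lookup (map (λ row → lookup row j) N) k)
      ≡⟨ sum-cong-≋ (λ k → cong (entry M i k *_) (Vec.lookup-map k _ N)) ⟩
    sum (λ k → entry M i k * entry N k j) ∎
    where open ≡-Reasoning

  +ᴹ-assoc : ∀ M N K → (M +ᴹ N) +ᴹ K ≡ M +ᴹ (N +ᴹ K)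
  +ᴹ-assoc M N K = matrix-ext λ i j → begin
    entry ((M +ᴹ N) +ᴹ K) i j               ≡⟨ entry-+ᴹ (M +ᴹ N) K i j ⟩
    entry (M +ᴹ N) i j + entry K i j         ≡⟨ cong (_+ entry K i j) (entry-+ᴹ M N i j) ⟩
    entry M i j + entry N i j + entry K i j  ≡⟨ +-assoc (entry M i j) _ _ ⟩
    entry M i j + (entry N i j + entry K i j) ≡⟨ cong (entry M i j +_) (entry-+ᴹ N K i j) ⟨
    entry M i j + entry (N +ᴹ K) i j         ≡⟨ entry-+ᴹ M (N +ᴹ K) i j ⟨
    entry (M +ᴹ (N +ᴹ K)) i j                ∎
    where open ≡-Reasoning

  +ᴹ-comm : ∀ M N → M +ᴹ N ≡ N +ᴹ M
  +ᴹ-comm M N = matrix-ext λ i j →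
    trans (entry-+ᴹ M N i j) (trans (+-comm (entry M i j) _) (sym (entry-+ᴹ N M i j)))

  +ᴹ-identityˡ : ∀ M → 0ᴹ +ᴹ M ≡ M
  +ᴹ-identityˡ M = matrix-ext λ i j →
    trans (entry-+ᴹ 0ᴹ M i j) (trans (cong (_+ entry M i j) (entry-0ᴹ i j)) (+-identityˡ (entry M i j)))

  *ᴹ-assoc : ∀ M N K → (M *ᴹ N) *ᴹ K ≡ M *ᴹ (N *ᴹ K)
  *ᴹ-assoc M N K = matrix-ext λ i j → begin
    entry ((M *ᴹ N) *ᴹ K) i j
      ≡⟨ entry-*ᴹ (M *ᴹ N) K i j ⟩
    sum (λ k → entry (M *ᴹ N) i k * entry K k j)
      ≡⟨ sum-cong-≋ (λ k → trans (cong (_* entry K k j) (entry-*ᴹ M N i k))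
                                 (*-distribʳ-sum (entry K k j) (λ l → entry M i l * entry N l k))) ⟩
    sum (λ k → sum (λ l → entry M i l * entry N l k * entry K k j))
      ≡⟨ ∑-comm (λ k l → entry M i l * entry N l k * entry K k j) ⟩
    sum (λ l → sum (λ k → entry M i l * entry N l k * entry K k j))
      ≡⟨ sum-cong-≋ (λ l → trans (sum-cong-≋ (λ k → *-assoc (entry M i l) (entry N l k) (entry K k j)))
                                 (sym (*-distribˡ-sum (entry M i l) (λ k → entry N l k * entry K k j)))) ⟩
    sum (λ l → entry M i l * sum (λ k → entry N l k * entry K k j))
      ≡⟨ sum-cong-≋ (λ l → cong (entry M i l *_) (entry-*ᴹ N K l j)) ⟨
    sum (λ l → entry M i l * entry (N *ᴹ K) l j)
      ≡⟨ entry-*ᴹ M (N *ᴹ K) i j ⟨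
    entry (M *ᴹ (N *ᴹ K)) i j ∎
    where open ≡-Reasoning

  *ᴹ-identityˡ : ∀ M → 1ᴹ *ᴹ M ≡ M
  *ᴹ-identityˡ M = matrix-ext λ i j → begin
    entry (1ᴹ *ᴹ M) i j
      ≡⟨ entry-*ᴹ 1ᴹ M i j ⟩
    sum (λ k → entry 1ᴹ i k * entry M k j)
      ≡⟨ sum-δ _ i (λ k k≢i → trans (cong (_* entry M k j) (entry-1ᴹ-off (k≢i ∘ sym))) (zeroˡ _)) ⟩
    entry 1ᴹ i i * entry M i j
      ≡⟨ cong (_* entry M i j) (entry-1ᴹ-diag i) ⟩
    1# * entry M i j
      ≡⟨ *-identityˡ (entry M i j) ⟩
    entry M i j ∎
    where open ≡-Reasoning

  *ᴹ-identityʳ : ∀ M → M *ᴹ 1ᴹ ≡ M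
  *ᴹ-identityʳ M = matrix-ext λ i j → begin
    entry (M *ᴹ 1ᴹ) i j
      ≡⟨ entry-*ᴹ M 1ᴹ i j ⟩
    sum (λ k → entry M i k * entry 1ᴹ k j)
      ≡⟨ sum-δ _ j (λ k k≢j → trans (cong (entry M i k *_) (entry-1ᴹ-off k≢j)) (zeroʳ _)) ⟩
    entry M i j * entry 1ᴹ j j
      ≡⟨ cong (entry M i j *_) (entry-1ᴹ-diag j) ⟩
    entry M i j * 1#
      ≡⟨ *-identityʳ (entry M i j) ⟩
    entry M i j ∎
    where open ≡-Reasoning

  *ᴹ-distribˡ-+ᴹ : ∀ M N K → M *ᴹ (N +ᴹ K) ≡ M *ᴹ N +ᴹ M *ᴹ K
  *ᴹ-distribˡ-+ᴹ M N K = matrix-ext λ i j → begin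
    entry (M *ᴹ (N +ᴹ K)) i j
      ≡⟨ entry-*ᴹ M (N +ᴹ K) i j ⟩
    sum (λ k → entry M i k * entry (N +ᴹ K) k j)
      ≡⟨ sum-cong-≋ (λ k → trans (cong (entry M i k *_) (entry-+ᴹ N K k j)) (distribˡ (entry M i k) _ _)) ⟩
    sum (λ k → entry M i k * entry N k j + entry M i k * entry K k j)
      ≡⟨ ∑-distrib-+ (λ k → entry M i k * entry N k j) _ ⟩
    sum (λ k → entry M i k * entry N k j) + sum (λ k → entry M i k * entry K k j)
      ≡⟨ cong₂ _+_ (entry-*ᴹ M N i j) (entry-*ᴹ M K i j) ⟨
    entry (M *ᴹ N) i j + entry (M *ᴹ K) i j
      ≡⟨ entry-+ᴹ (M *ᴹ N) (M *ᴹ K) i j ⟨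
    entry (M *ᴹ N +ᴹ M *ᴹ K) i j ∎
    where open ≡-Reasoning

  *ᴹ-distribʳ-+ᴹ : ∀ M N K → (N +ᴹ K) *ᴹ M ≡ N *ᴹ M +ᴹ K *ᴹ M
  *ᴹ-distribʳ-+ᴹ M N K = matrix-ext λ i j → begin
    entry ((N +ᴹ K) *ᴹ M) i j
      ≡⟨ entry-*ᴹ (N +ᴹ K) M i j ⟩
    sum (λ k → entry (N +ᴹ K) i k * entry M k j)
      ≡⟨ sum-cong-≋ (λ k → trans (cong (_* entry M k j) (entry-+ᴹ N K i k)) (distribʳ (entry M k j) _ _)) ⟩
    sum (λ k → entry N i k * entry M k j + entry K i k * entry M k j)
      ≡⟨ ∑-distrib-+ (λ k → entry N i k * entry M k j) _ ⟩
    sum (λ k → entry N i k * entry M k j) + sum (λ k → entry K i k * entry M k j)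
      ≡⟨ cong₂ _+_ (entry-*ᴹ N M i j) (entry-*ᴹ K M i j) ⟨
    entry (N *ᴹ M) i j + entry (K *ᴹ M) i j
      ≡⟨ entry-+ᴹ (N *ᴹ M) (K *ᴹ M) i j ⟨
    entry (N *ᴹ M +ᴹ K *ᴹ M) i j ∎
    where open ≡-Reasoning

  *ᴹ-zeroˡ : ∀ M → 0ᴹ *ᴹ M ≡ 0ᴹ
  *ᴹ-zeroˡ M = matrix-ext λ i j → trans (entry-*ᴹ 0ᴹ M i j) (trans
    (sum-zero _ (λ k → trans (cong (_* entry M k j) (entry-0ᴹ i k)) (zeroˡ _))) (sym (entry-0ᴹ i j)))

  *ᴹ-zeroʳ : ∀ M → M *ᴹ 0ᴹ ≡ 0ᴹ
  *ᴹ-zeroʳ M = matrix-ext λ i j → trans (entry-*ᴹ M 0ᴹ i j) (trans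
    (sum-zero _ (λ k → trans (cong (entry M i k *_) (entry-0ᴹ k j)) (zeroʳ _))) (sym (entry-0ᴹ i j)))

  isSemiring : IsSemiring _≡_ _+ᴹ_ _*ᴹ_ 0ᴹ 1ᴹ
  isSemiring = record
    { isSemiringWithoutAnnihilatingZero = record
      { +-isCommutativeMonoid = isCommutativeMonoidˡ record
        { isSemigroup = record { isMagma = record { isEquivalence = isEquivalence ; ∙-cong = cong₂ _+ᴹ_ } ; assoc = +ᴹ-assoc }
        ; identityˡ = +ᴹ-identityˡ
        ; comm = +ᴹ-comm
        }
      ; *-cong = cong₂ _*ᴹ_
      ; *-assoc = *ᴹ-assoc
      ; *-identity = *ᴹ-identityˡ , *ᴹ-identityʳ
      ; distrib = *ᴹ-distribˡ-+ᴹ , *ᴹ-distribʳ-+ᴹ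
      }
    ; zero = *ᴹ-zeroˡ , *ᴹ-zeroʳ
    }

  matrixSemiring : Semiring 0ℓ 0ℓ
  matrixSemiring = record { isSemiring = isSemiring }

  infixr 6 _·ᵛ_
  infixl 5 _+ᵛ_

  _·ᵛ_ : Mat → Vec A m → Vec A m
  M ·ᵛ v = map (λ row → dot row v) M

  _+ᵛ_ : Vec A m → Vec A m → Vec A m
  _+ᵛ_ = zipWith _+_

  0ᵛ : Vec A m
  0ᵛ = replicate m 0#

  lookup-·ᵛ : ∀ M v i → lookup (M ·ᵛ v) i ≡ sum (λ k → entry M i k * lookup v k)
  lookup-·ᵛ M v i = trans (Vec.lookup-map i _ M) (dot≡sum (lookup M i) v)

  *ᴹ-·ᵛ : ∀ M N v → (M *ᴹ N) ·ᵛ v ≡ M ·ᵛ N ·ᵛ v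
  *ᴹ-·ᵛ M N v = vec-ext λ i → begin
    lookup ((M *ᴹ N) ·ᵛ v) i
      ≡⟨ lookup-·ᵛ (M *ᴹ N) v i ⟩
    sum (λ k → entry (M *ᴹ N) i k * lookup v k)
      ≡⟨ sum-cong-≋ (λ k → trans (cong (_* lookup v k) (entry-*ᴹ M N i k))
                                 (*-distribʳ-sum (lookup v k) (λ l → entry M i l * entry N l k))) ⟩
    sum (λ k → sum (λ l → entry M i l * entry N l k * lookup v k))
      ≡⟨ ∑-comm (λ k l → entry M i l * entry N l k * lookup v k) ⟩
    sum (λ l → sum (λ k → entry M i l * entry N l k * lookup v k))
      ≡⟨ sum-cong-≋ (λ l → trans (sum-cong-≋ (λ k → *-assoc (entry M i l) (entry N l k) (lookup v k)))
                               (sym (*-distribˡ-sum (entry M i l) (λ k → entry N l k * lookup v k)))) ⟩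
    sum (λ l → entry M i l * sum (λ k → entry N l k * lookup v k))
      ≡⟨ sum-cong-≋ (λ l → cong (entry M i l *_) (lookup-·ᵛ N v l)) ⟨
    sum (λ l → entry M i l * lookup (N ·ᵛ v) l)
      ≡⟨ lookup-·ᵛ M (N ·ᵛ v) i ⟨
    lookup (M ·ᵛ N ·ᵛ v) i ∎
    where open ≡-Reasoning

  +ᴹ-·ᵛ : ∀ M N v → (M +ᴹ N) ·ᵛ v ≡ M ·ᵛ v +ᵛ N ·ᵛ v
  +ᴹ-·ᵛ M N v = vec-ext λ i → begin
    lookup ((M +ᴹ N) ·ᵛ v) i
      ≡⟨ lookup-·ᵛ (M +ᴹ N) v i ⟩
    sum (λ k → entry (M +ᴹ N) i k * lookup v k)
      ≡⟨ sum-cong-≋ (λ k → trans (cong (_* lookup v k) (entry-+ᴹ M N i k)) (distribʳ (lookup v k) _ _)) ⟩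
    sum (λ k → entry M i k * lookup v k + entry N i k * lookup v k)
      ≡⟨ ∑-distrib-+ (λ k → entry M i k * lookup v k) _ ⟩
    sum (λ k → entry M i k * lookup v k) + sum (λ k → entry N i k * lookup v k)
      ≡⟨ cong₂ _+_ (lookup-·ᵛ M v i) (lookup-·ᵛ N v i) ⟨
    lookup (M ·ᵛ v) i + lookup (N ·ᵛ v) i
      ≡⟨ Vec.lookup-zipWith _+_ i (M ·ᵛ v) (N ·ᵛ v) ⟨
    lookup (M ·ᵛ v +ᵛ N ·ᵛ v) i ∎
    where open ≡-Reasoning

  1ᴹ-·ᵛ : ∀ v → 1ᴹ ·ᵛ v ≡ v
  1ᴹ-·ᵛ v = vec-ext λ i → begin
    lookup (1ᴹ ·ᵛ v) i
      ≡⟨ lookup-·ᵛ 1ᴹ v i ⟩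
    sum (λ k → entry 1ᴹ i k * lookup v k)
      ≡⟨ sum-δ _ i (λ k k≢i → trans (cong (_* lookup v k) (entry-1ᴹ-off (k≢i ∘ sym))) (zeroˡ _)) ⟩
    entry 1ᴹ i i * lookup v i
      ≡⟨ cong (_* lookup v i) (entry-1ᴹ-diag i) ⟩
    1# * lookup v i
      ≡⟨ *-identityˡ (lookup v i) ⟩
    lookup v i ∎
    where open ≡-Reasoning

  0ᴹ-·ᵛ : ∀ v → 0ᴹ ·ᵛ v ≡ 0ᵛ
  0ᴹ-·ᵛ v = vec-ext λ i → trans (lookup-·ᵛ 0ᴹ v i) (trans
    (sum-zero _ (λ k → trans (cong (_* lookup v k) (entry-0ᴹ i k)) (zeroˡ _))) (sym (Vec.lookup-replicate i 0#)))

  open import Algebra.Properties.Semiring.Mult semiring using (_×_)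
  module ᴹ = SemiringPowers matrixSemiring

  entry-× : ∀ n M i j → entry (n ᴹ.× M) i j ≡ n × entry M i j
  entry-× zero M i j = entry-0ᴹ i j
  entry-× (suc n) M i j = trans (entry-+ᴹ M (n ᴹ.× M) i j) (cong (entry M i j +_) (entry-× n M i j))

  entry-sum : ∀ {n} (f : Fin n → Mat) i j → entry (ᴹ.sum f) i j ≡ sum (λ k → entry (f k) i j)
  entry-sum {zero} f i j = entry-0ᴹ i j
  entry-sum {suc n} f i j = trans (entry-+ᴹ (f zero) (ᴹ.sum {n} (λ k → f (suc k))) i j)
                                  (cong (entry (f zero) i j +_) (entry-sum {n} (λ k → f (suc k)) i j))

  p×1≡0⇒p×1ᴹ≡0ᴹ : ∀ {p} → p × 1# ≡ 0# → p ᴹ.× 1ᴹ ≡ 0ᴹ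
  p×1≡0⇒p×1ᴹ≡0ᴹ {p} p×1≡0 = matrix-ext λ i j → begin
    entry (p ᴹ.× 1ᴹ) i j          ≡⟨ entry-× p 1ᴹ i j ⟩
    p × entry 1ᴹ i j              ≡⟨ SemiringPowers.×≈×1* semiring p (entry 1ᴹ i j) ⟩
    (p × 1#) * entry 1ᴹ i j       ≡⟨ cong (_* entry 1ᴹ i j) p×1≡0 ⟩
    0# * entry 1ᴹ i j             ≡⟨ zeroˡ _ ⟩
    0#                            ≡⟨ entry-0ᴹ i j ⟨
    entry 0ᴹ i j                  ∎
    where open ≡-Reasoning

  shiftMatrix : Mat
  shiftMatrix = matrix (λ i j → δ (toℕ j) (suc (toℕ i)))

  jordanBlock : Mat
  jordanBlock = matrix (λ i j → if (toℕ j ≡ᵇ toℕ i) ∨ (toℕ j ≡ᵇ suc (toℕ i)) then 1# else 0#)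

  jordanBlock≡1ᴹ+ᴹshiftMatrix : jordanBlock ≡ 1ᴹ +ᴹ shiftMatrix
  jordanBlock≡1ᴹ+ᴹshiftMatrix = matrix-ext λ i j → begin
    entry jordanBlock i j
      ≡⟨ entry-matrix _ i j ⟩
    (if (toℕ j ≡ᵇ toℕ i) ∨ (toℕ j ≡ᵇ suc (toℕ i)) then 1# else 0#)
      ≡⟨ split (toℕ i) (toℕ j) ⟩
    δ (toℕ i) (toℕ j) + δ (toℕ j) (suc (toℕ i))
      ≡⟨ cong₂ _+_ (entry-matrix _ i j) (entry-matrix _ i j) ⟨
    entry 1ᴹ i j + entry shiftMatrix i j
      ≡⟨ entry-+ᴹ 1ᴹ shiftMatrix i j ⟨
    entry (1ᴹ +ᴹ shiftMatrix) i j ∎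
    where
    open ≡-Reasoning
    split : ∀ a b → (if (b ≡ᵇ a) ∨ (b ≡ᵇ suc a) then 1# else 0#) ≡ δ a b + δ b (suc a)
    split a b with b ℕ.≟ a
    ... | yes refl = begin
      (if (a ≡ᵇ a) ∨ (a ≡ᵇ suc a) then 1# else 0#)
        ≡⟨ cong (λ t → if t ∨ (a ≡ᵇ suc a) then 1# else 0#) (≡ᵇ-true {a} refl) ⟩
      1#                                            ≡⟨ +-identityʳ 1# ⟨
      1# + 0#                                       ≡⟨ cong₂ _+_ (δ-≡ {a} refl) (δ-≢ {a} (ℕ.1+n≢n ∘ sym)) ⟨
      δ a a + δ a (suc a)                           ∎
    ... | no b≢a = begin
      (if (b ≡ᵇ a) ∨ (b ≡ᵇ suc a) then 1# else 0#)
        ≡⟨ cong (λ t → if t ∨ (b ≡ᵇ suc a) then 1# else 0#) (≡ᵇ-false b≢a) ⟩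
      δ b (suc a)                                   ≡⟨ +-identityˡ _ ⟨
      0# + δ b (suc a)                              ≡⟨ cong (_+ δ b (suc a)) (δ-≢ {a} (b≢a ∘ sym)) ⟨
      δ a b + δ b (suc a)                           ∎

  entry-shiftMatrix^ : ∀ k i j → entry (shiftMatrix ᴹ.^ k) i j ≡ δ (toℕ j) (toℕ i ℕ.+ k)
  entry-shiftMatrix^ zero i j with toℕ j ℕ.≟ toℕ i ℕ.+ 0
  ... | yes j≡i+0 = trans (entry-matrix _ i j) (trans (δ-≡ (sym (trans j≡i+0 (ℕ.+-identityʳ _)))) (sym (δ-≡ j≡i+0)))
  ... | no j≢i+0 = trans (entry-matrix _ i j)
    (trans (δ-≢ (λ i≡j → j≢i+0 (trans (sym i≡j) (sym (ℕ.+-identityʳ _))))) (sym (δ-≢ j≢i+0)))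
  entry-shiftMatrix^ (suc k) i j = begin
    entry (shiftMatrix *ᴹ shiftMatrix ᴹ.^ k) i j
      ≡⟨ entry-*ᴹ shiftMatrix (shiftMatrix ᴹ.^ k) i j ⟩
    sum (λ l → entry shiftMatrix i l * entry (shiftMatrix ᴹ.^ k) l j)
      ≡⟨ sum-cong-≋ {m} (λ l → cong₂ _*_ (entry-matrix _ i l) (entry-shiftMatrix^ k l j)) ⟩
    sum {m} (λ l → δ (toℕ l) (suc (toℕ i)) * δ (toℕ j) (toℕ l ℕ.+ k))
      ≡⟨ path-count ⟩
    δ (toℕ j) (toℕ i ℕ.+ suc k) ∎
    where
    open ≡-Reasoning
    path-count : sum {m} (λ l → δ (toℕ l) (suc (toℕ i)) * δ (toℕ j) (toℕ l ℕ.+ k)) ≡ δ (toℕ j) (toℕ i ℕ.+ suc k)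
    path-count with toℕ j ℕ.≟ toℕ i ℕ.+ suc k
    ... | yes j≡i+1+k = trans (sum-δ {m} _ next off-path) (trans on-path (sym (δ-≡ j≡i+1+k)))
      where
      i+1<m : suc (toℕ i) < m
      i+1<m = ℕ.≤-<-trans (ℕ.m≤m+n (suc (toℕ i)) k) (subst (_< m) (trans j≡i+1+k (ℕ.+-suc (toℕ i) k)) (toℕ<n j))
      next : Fin m
      next = fromℕ< i+1<m
      off-path : ∀ l → l ≢ next → δ (toℕ l) (suc (toℕ i)) * δ (toℕ j) (toℕ l ℕ.+ k) ≡ 0#
      off-path l l≢next = trans (cong (_* _) (δ-≢ (λ l≡ → l≢next (toℕ-injective (trans l≡ (sym (toℕ-fromℕ< i+1<m))))))) (zeroˡ _)
      on-path : δ (toℕ next) (suc (toℕ i)) * δ (toℕ j) (toℕ next ℕ.+ k) ≡ 1#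
      on-path = trans (cong₂ _*_ (δ-≡ (toℕ-fromℕ< i+1<m))
                                  (δ-≡ (trans j≡i+1+k (trans (ℕ.+-suc (toℕ i) k) (cong (ℕ._+ k) (sym (toℕ-fromℕ< i+1<m)))))))
                      (*-identityˡ 1#)
    ... | no j≢i+1+k = trans (sum-zero {m} _ no-path) (sym (δ-≢ j≢i+1+k))
      where
      no-path : ∀ l → δ (toℕ l) (suc (toℕ i)) * δ (toℕ j) (toℕ l ℕ.+ k) ≡ 0#
      no-path l with toℕ l ℕ.≟ suc (toℕ i)
      ... | yes l≡i+1 = trans (cong (_ *_) (δ-≢ (λ j≡l+k → j≢i+1+k
                              (trans j≡l+k (trans (cong (ℕ._+ k) l≡i+1) (sym (ℕ.+-suc (toℕ i) k)))))))
                              (zeroʳ _)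
      ... | no l≢i+1 = trans (cong (_* _) (δ-≢ l≢i+1)) (zeroˡ _)

  shiftMatrix^m≡0ᴹ : shiftMatrix ᴹ.^ m ≡ 0ᴹ
  shiftMatrix^m≡0ᴹ = matrix-ext λ i j → trans (entry-shiftMatrix^ m i j)
    (trans (δ-≢ (ℕ.<⇒≢ (ℕ.<-≤-trans (toℕ<n j) (ℕ.m≤n+m m (toℕ i))))) (sym (entry-0ᴹ i j)))

  open ᴹ.Unipotent shiftMatrix m shiftMatrix^m≡0ᴹ using (poly)

  entry-poly : ∀ c {i₀} j → toℕ i₀ ≡ 0 → entry (poly c) i₀ j ≡ c (toℕ j) × 1#
  entry-poly c {i₀} j i₀≡0 = begin
    entry (poly c) i₀ j
      ≡⟨ entry-sum {m} (λ l → c (toℕ l) ᴹ.× shiftMatrix ᴹ.^ toℕ l) i₀ j ⟩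
    sum {m} (λ l → entry (c (toℕ l) ᴹ.× shiftMatrix ᴹ.^ toℕ l) i₀ j)
      ≡⟨ sum-cong-≋ {m} (λ l → trans (entry-× (c (toℕ l)) (shiftMatrix ᴹ.^ toℕ l) i₀ j)
                                     (cong (c (toℕ l) ×_) (entry-shiftMatrix^ (toℕ l) i₀ j))) ⟩
    sum {m} (λ l → c (toℕ l) × δ (toℕ j) (toℕ i₀ ℕ.+ toℕ l))
      ≡⟨ sum-δ {m} _ j off-diagonal ⟩
    c (toℕ j) × δ (toℕ j) (toℕ i₀ ℕ.+ toℕ j)
      ≡⟨ cong (c (toℕ j) ×_) (δ-≡ (sym (cong (ℕ._+ toℕ j) i₀≡0))) ⟩
    c (toℕ j) × 1# ∎
    where
    open ≡-Reasoning
    off-diagonal : ∀ l → l ≢ j → c (toℕ l) × δ (toℕ j) (toℕ i₀ ℕ.+ toℕ l) ≡ 0#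
    off-diagonal l l≢j = begin
      c (toℕ l) × δ (toℕ j) (toℕ i₀ ℕ.+ toℕ l)
        ≡⟨ cong (c (toℕ l) ×_) (δ-≢ (λ j≡ → l≢j (toℕ-injective (sym (trans j≡ (cong (ℕ._+ toℕ l) i₀≡0)))))) ⟩
      c (toℕ l) × 0#
        ≡⟨ SemiringPowers.×≈×1* semiring (c (toℕ l)) 0# ⟩
      (c (toℕ l) × 1#) * 0#
        ≡⟨ zeroʳ _ ⟩
      0# ∎

  unitVector : Fin m → Vec A m
  unitVector j = tabulate (λ k → δ (toℕ k) (toℕ j))

  lookup-·ᵛ-unitVector : ∀ M i j → lookup (M ·ᵛ unitVector j) i ≡ entry M i j
  lookup-·ᵛ-unitVector M i j = begin
    lookup (M ·ᵛ unitVector j) i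
      ≡⟨ lookup-·ᵛ M (unitVector j) i ⟩
    sum (λ k → entry M i k * lookup (unitVector j) k)
      ≡⟨ sum-δ _ j off-diagonal ⟩
    entry M i j * lookup (unitVector j) j
      ≡⟨ cong (entry M i j *_) (trans (Vec.lookup∘tabulate _ j) (δ-≡ {toℕ j} refl)) ⟩
    entry M i j * 1#
      ≡⟨ *-identityʳ _ ⟩
    entry M i j ∎
    where
    open ≡-Reasoning
    off-diagonal : ∀ k → k ≢ j → entry M i k * lookup (unitVector j) k ≡ 0#
    off-diagonal k k≢j =
      trans (cong (entry M i k *_) (trans (Vec.lookup∘tabulate _ k) (δ-≢ {toℕ k} (k≢j ∘ toℕ-injective)))) (zeroʳ _)

module ResidueSemiring (p : ℕ) .{{_ : NonZero p}} (m : ℕ) where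

  open import Defs using (F; _+F_; _*F_; 0F; 1F)
  open import Algebra.Structures.Biased using (isCommutativeSemiringˡ; isCommutativeMonoidˡ)
  open import Data.Nat.Base using (zero; suc; _+_; _*_; _<_)
  open import Data.Nat.Properties
  open import Data.Nat.DivMod
  open import Data.Nat.Divisibility using (_∣_; m%n≡0⇒n∣m; n∣m⇒m%n≡0)
  open import Data.Fin.Base using (toℕ)
  open import Data.Fin.Properties using (toℕ-fromℕ<; toℕ-injective; toℕ<n)
  open import Level using (0ℓ)
  open import Relation.Binary.PropositionalEquality hiding ([_])

  [_] : ℕ → F p m
  [ x ] = x mod p

  toℕ-[] : ∀ x → toℕ [ x ] ≡ x % p
  toℕ-[] x = toℕ-fromℕ< (m%n<n x p)

  []-cong : ∀ {x y} → x % p ≡ y % p → [ x ] ≡ [ y ]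
  []-cong {x} {y} eq = toℕ-injective (trans (toℕ-[] x) (trans eq (sym (toℕ-[] y))))

  [toℕ] : ∀ a → [ toℕ a ] ≡ a
  [toℕ] a = toℕ-injective (trans (toℕ-[] (toℕ a)) (m<n⇒m%n≡m (toℕ<n a)))

  [x%p+y]≡[x+y] : ∀ x y → [ x % p + y ] ≡ [ x + y ]
  [x%p+y]≡[x+y] x y = []-cong (begin
    (x % p + y) % p             ≡⟨ %-distribˡ-+ (x % p) y p ⟩
    (x % p % p + y % p) % p     ≡⟨ cong (λ z → (z + y % p) % p) (m%n%n≡m%n x p) ⟩
    (x % p + y % p) % p         ≡⟨ %-distribˡ-+ x y p ⟨
    (x + y) % p                 ∎)
    where open ≡-Reasoning

  [x%p*y]≡[x*y] : ∀ x y → [ x % p * y ] ≡ [ x * y ]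
  [x%p*y]≡[x*y] x y = []-cong (begin
    (x % p * y) % p             ≡⟨ %-distribˡ-* (x % p) y p ⟩
    (x % p % p * (y % p)) % p   ≡⟨ cong (λ z → (z * (y % p)) % p) (m%n%n≡m%n x p) ⟩
    (x % p * (y % p)) % p       ≡⟨ %-distribˡ-* x y p ⟨
    (x * y) % p                 ∎)
    where open ≡-Reasoning

  [[x]+y]≡[x+y] : ∀ x y → [ toℕ [ x ] + y ] ≡ [ x + y ]
  [[x]+y]≡[x+y] x y = trans (cong (λ z → [ z + y ]) (toℕ-[] x)) ([x%p+y]≡[x+y] x y)

  [x+[y]]≡[x+y] : ∀ x y → [ x + toℕ [ y ] ] ≡ [ x + y ]
  [x+[y]]≡[x+y] x y = trans (cong [_] (+-comm x _)) (trans ([[x]+y]≡[x+y] y x) (cong [_] (+-comm y x)))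

  [[x]*y]≡[x*y] : ∀ x y → [ toℕ [ x ] * y ] ≡ [ x * y ]
  [[x]*y]≡[x*y] x y = trans (cong (λ z → [ z * y ]) (toℕ-[] x)) ([x%p*y]≡[x*y] x y)

  [x*[y]]≡[x*y] : ∀ x y → [ x * toℕ [ y ] ] ≡ [ x * y ]
  [x*[y]]≡[x*y] x y = trans (cong [_] (*-comm x _)) (trans ([[x]*y]≡[x*y] y x) (cong [_] (*-comm y x)))

  *F-distribʳ-+F : ∀ a b c → _*F_ p m (_+F_ p m b c) a ≡ _+F_ p m (_*F_ p m b a) (_*F_ p m c a)
  *F-distribʳ-+F a b c = begin
    [ toℕ [ b′ + c′ ] * a′ ]              ≡⟨ [[x]*y]≡[x*y] (b′ + c′) a′ ⟩
    [ (b′ + c′) * a′ ]                    ≡⟨ cong [_] (*-distribʳ-+ a′ b′ c′) ⟩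
    [ b′ * a′ + c′ * a′ ]                 ≡⟨ [[x]+y]≡[x+y] (b′ * a′) (c′ * a′) ⟨
    [ toℕ [ b′ * a′ ] + c′ * a′ ]         ≡⟨ [x+[y]]≡[x+y] (toℕ [ b′ * a′ ]) (c′ * a′) ⟨
    [ toℕ [ b′ * a′ ] + toℕ [ c′ * a′ ] ] ∎
    where
    open ≡-Reasoning
    a′ b′ c′ : ℕ
    a′ = toℕ a
    b′ = toℕ b
    c′ = toℕ c

  isCommutativeSemiring : IsCommutativeSemiring _≡_ (_+F_ p m) (_*F_ p m) (0F p m) (1F p m)
  isCommutativeSemiring = isCommutativeSemiringˡ record
    { +-isCommutativeMonoid = isCommutativeMonoidˡ record
      { isSemigroup = record
        { isMagma = record { isEquivalence = isEquivalence ; ∙-cong = cong₂ (_+F_ p m) }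
        ; assoc = λ a b c → trans ([[x]+y]≡[x+y] (toℕ a + toℕ b) (toℕ c))
            (trans (cong [_] (+-assoc (toℕ a) (toℕ b) (toℕ c))) (sym ([x+[y]]≡[x+y] (toℕ a) (toℕ b + toℕ c))))
        }
      ; identityˡ = λ a → trans ([[x]+y]≡[x+y] 0 (toℕ a)) ([toℕ] a)
      ; comm = λ a b → cong [_] (+-comm (toℕ a) (toℕ b))
      }
    ; *-isCommutativeMonoid = isCommutativeMonoidˡ record
      { isSemigroup = record
        { isMagma = record { isEquivalence = isEquivalence ; ∙-cong = cong₂ (_*F_ p m) }
        ; assoc = λ a b c → trans ([[x]*y]≡[x*y] (toℕ a * toℕ b) (toℕ c))
            (trans (cong [_] (*-assoc (toℕ a) (toℕ b) (toℕ c))) (sym ([x*[y]]≡[x*y] (toℕ a) (toℕ b * toℕ c))))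
        }
      ; identityˡ = λ a → trans ([[x]*y]≡[x*y] 1 (toℕ a)) (trans (cong [_] (*-identityˡ (toℕ a))) ([toℕ] a))
      ; comm = λ a b → cong [_] (*-comm (toℕ a) (toℕ b))
      }
    ; distribʳ = *F-distribʳ-+F
    ; zeroˡ = λ a → [[x]*y]≡[x*y] 0 (toℕ a)
    }

  commutativeSemiring : CommutativeSemiring 0ℓ 0ℓ
  commutativeSemiring = record { isCommutativeSemiring = isCommutativeSemiring }

  open import Algebra.Properties.Semiring.Mult (CommutativeSemiring.semiring commutativeSemiring) using (_×_)

  n×1≡[n] : ∀ n → n × 1F p m ≡ [ n ]
  n×1≡[n] zero = refl
  n×1≡[n] (suc n) = begin
    [ toℕ [ 1 ] + toℕ (n × 1F p m) ] ≡⟨ cong (λ a → [ toℕ [ 1 ] + toℕ a ]) (n×1≡[n] n) ⟩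
    [ toℕ [ 1 ] + toℕ [ n ] ]         ≡⟨ [[x]+y]≡[x+y] 1 (toℕ [ n ]) ⟩
    [ 1 + toℕ [ n ] ]                 ≡⟨ [x+[y]]≡[x+y] 1 n ⟩
    [ suc n ]                         ∎
    where open ≡-Reasoning

  p∣n⇒n×1≡0 : ∀ {n} → p ∣ n → n × 1F p m ≡ 0F p m
  p∣n⇒n×1≡0 {n} p∣n = trans (n×1≡[n] n) ([]-cong (trans (n∣m⇒m%n≡0 n p p∣n) (sym (m*n%n≡0 0 p))))

  n×1≡0⇒p∣n : ∀ {n} → n × 1F p m ≡ 0F p m → p ∣ n
  n×1≡0⇒p∣n {n} eq = m%n≡0⇒n∣m n p (begin
    n % p                    ≡⟨ toℕ-[] n ⟨
    toℕ [ n ]                ≡⟨ cong toℕ (trans (sym (n×1≡[n] n)) eq) ⟩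
    toℕ [ 0 ]                ≡⟨ toℕ-[] 0 ⟩
    0 % p                    ≡⟨ m*n%n≡0 0 p ⟩
    0                        ∎)
    where open ≡-Reasoning

  1≢0 : 1 < p → 1F p m ≢ 0F p m
  1≢0 1<p eq = 1+n≢0 (begin
    1                        ≡⟨ m<n⇒m%n≡m 1<p ⟨
    1 % p                    ≡⟨ toℕ-[] 1 ⟨
    toℕ [ 1 ]                ≡⟨ cong toℕ eq ⟩
    toℕ [ 0 ]                ≡⟨ toℕ-[] 0 ⟩
    0 % p                    ≡⟨ m*n%n≡0 0 p ⟩
    0                        ∎)
    where open ≡-Reasoning

open import Defs using (F; 0F; 1F; jordan; matPow; _∙_; _^ᴳ_; G; raw; HasOrder; Kills; HasExponent)
open import Data.Nat.Base using (zero; suc; _+_; _*_; _∸_; _^_; _≤_; _<_; s≤s; z≤n)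
import Data.Nat.Base as ℕ
import Data.Nat.Properties as ℕ
open import Data.Nat.Combinatorics using (_C_; nCn≡1)
open import Data.Nat.Divisibility using (_∣_; divides; ∣-refl; ∣⇒≤; *-monoˡ-∣)
open import Data.Nat.DivMod using (_%_; m%n<n)
open import Data.Nat.Primality using (Prime; prime⇒nonZero; prime⇒nonTrivial)
open import Data.Fin.Base using (Fin; toℕ; fromℕ<)
open import Data.Fin.Properties using (toℕ-fromℕ<; toℕ-injective; toℕ<n; *↔×)
open import Data.Product.Base using (_×_; _,_; proj₁; proj₂; ∃-syntax)
open import Data.Product.Algebra using (×-cong)
open import Data.Vec.Base using (Vec; lookup)
open import Data.Vec.Properties using (lookup-replicate)
open import Data.Vec.Recursive using (Fin[m^n]↔Fin[m]^n)
open import Data.Vec.Recursive.Properties using (↔Vec)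
open import Function.Base using (_∘_)
open import Function.Bundles using (_↔_; Inverse)
open import Function.Properties.Inverse using (↔-refl; ↔-trans)
open import Relation.Binary.PropositionalEquality using (_≢_; refl; sym; trans; cong; cong₂; subst; module ≡-Reasoning)

hasOrder-from-bijection : ∀ {p} .{{_ : NonZero p}} {m N} {X : Set} (e : Fin N ↔ X) (φ : X → G p m) →
  (∀ x y → raw p m (φ x) ≡ raw p m (φ y) → x ≡ y) → (∀ g → ∃[ x ] raw p m (φ x) ≡ raw p m g) →
  HasOrder p m N
hasOrder-from-bijection e φ φ-injective φ-surjective =
  φ ∘ to , (λ i j eq → trans (sym (strictlyInverseʳ i)) (trans (cong from (φ-injective _ _ eq)) (strictlyInverseʳ j))) ,
  λ g → let (x , eq) = φ-surjective g in from x , trans (cong (raw _ _ ∘ φ) (strictlyInverseˡ x)) eq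
  where open Inverse e

hasExponent : ∀ {p} .{{_ : NonZero p}} {m} E → 0 < E → Kills p m E → (∀ k → Kills p m k → E ∣ k) →
              HasExponent p m E
hasExponent E 0<E E-kills E∣ = 0<E , E-kills , λ k 0<k k-kills → ∣⇒≤ {{ℕ.>-nonZero 0<k}} (E∣ k k-kills)

module JordanHolomorph (p : ℕ) (p-prime : Prime p) (m : ℕ) (0<m : 0 < m) where

  private instance
    p≢0 : NonZero p
    p≢0 = prime⇒nonZero p-prime

  open ResidueSemiring p m using (isCommutativeSemiring; commutativeSemiring; n×1≡[n]; p∣n⇒n×1≡0; n×1≡0⇒p∣n; 1≢0)
  open import Algebra.Properties.Semiring.Mult (CommutativeSemiring.semiring commutativeSemiring)
    using () renaming (_×_ to _×ᶠ_)
  open SquareMatrices isCommutativeSemiring m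
  open ᴹ using (geom; commute-+; commute-1; commute-geom; ^-distrib-*; ^-suc; geom-*-period;
    [1+z]^k≈1+z*geom[1+z]k; ^≈1⇒p^[1+n]∣; ^-injective; ^-mod; module Unipotent)
    renaming (_^_ to _^ᴹ_; _×_ to _×ᴹ_)
  open Unipotent shiftMatrix m shiftMatrix^m≡0ᴹ using (poly; [1+z]^k≈poly[kC]; geom[1+z]k≈poly[kC[1+_]])

  J N : Mat
  J = jordan p m
  N = shiftMatrix

  J≡1ᴹ+ᴹN : J ≡ 1ᴹ +ᴹ N
  J≡1ᴹ+ᴹN = jordanBlock≡1ᴹ+ᴹshiftMatrix

  matPow≡^ᴹ : ∀ A k → matPow p m A k ≡ A ^ᴹ k
  matPow≡^ᴹ A zero = refl
  matPow≡^ᴹ A (suc k) = trans (cong (_*ᴹ A) (matPow≡^ᴹ A k)) (^-suc A k)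

  ^ᴳ-formula : ∀ β v k → _^ᴳ_ p m (β , v) k ≡ (β ^ᴹ k , geom β k ·ᵛ v)
  ^ᴳ-formula β v zero = cong (1ᴹ ,_) (sym (0ᴹ-·ᵛ v))
  ^ᴳ-formula β v (suc k) = begin
    _∙_ p m (_^ᴳ_ p m (β , v) k) (β , v)
      ≡⟨ cong (λ x → _∙_ p m x (β , v)) (^ᴳ-formula β v k) ⟩
    (β *ᴹ β ^ᴹ k , β ·ᵛ geom β k ·ᵛ v +ᵛ v)
      ≡⟨ cong (β ^ᴹ suc k ,_) (cong₂ _+ᵛ_ (*ᴹ-·ᵛ β (geom β k) v) (1ᴹ-·ᵛ v)) ⟨
    (β ^ᴹ suc k , (β *ᴹ geom β k) ·ᵛ v +ᵛ 1ᴹ ·ᵛ v)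
      ≡⟨ cong (β ^ᴹ suc k ,_) (+ᴹ-·ᵛ (β *ᴹ geom β k) 1ᴹ v) ⟨
    (β ^ᴹ suc k , geom β (suc k) ·ᵛ v) ∎
    where open ≡-Reasoning

  p×1ᴹ≡0ᴹ : p ×ᴹ 1ᴹ ≡ 0ᴹ
  p×1ᴹ≡0ᴹ = p×1≡0⇒p×1ᴹ≡0ᴹ {p} (p∣n⇒n×1≡0 ∣-refl)

  J^p^e≡1ᴹ : ∀ e → m ≤ p ^ e → J ^ᴹ (p ^ e) ≡ 1ᴹ
  J^p^e≡1ᴹ e m≤p^e = subst (λ A → A ^ᴹ (p ^ e) ≡ 1ᴹ) (sym J≡1ᴹ+ᴹN)
    (Unipotent.[1+z]^p^e≈1 N m shiftMatrix^m≡0ᴹ p-prime p×1ᴹ≡0ᴹ 0<m e m≤p^e)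

  i₀ : Fin m
  i₀ = fromℕ< 0<m

  J^r≢1ᴹ : ∀ r → 0 < r → r < m → J ^ᴹ r ≢ 1ᴹ
  J^r≢1ᴹ r 0<r r<m J^r≡1ᴹ = 1≢0 (ℕ.nonTrivial⇒n>1 p {{prime⇒nonTrivial p-prime}}) (begin
    1F p m                          ≡⟨ trans (cong (_×ᶠ 1F p m) (nCn≡1 r)) (n×1≡[n] 1) ⟨
    (r C r) ×ᶠ 1F p m                ≡⟨ cong (λ t → (r C t) ×ᶠ 1F p m) (toℕ-fromℕ< r<m) ⟨
    (r C toℕ jᵣ) ×ᶠ 1F p m           ≡⟨ entry-poly (r C_) jᵣ (toℕ-fromℕ< 0<m) ⟨
    entry (poly (r C_)) i₀ jᵣ       ≡⟨ cong (λ A → entry A i₀ jᵣ) ([1+z]^k≈poly[kC] 0<m r) ⟨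
    entry ((1ᴹ +ᴹ N) ^ᴹ r) i₀ jᵣ    ≡⟨ cong (λ A → entry (A ^ᴹ r) i₀ jᵣ) J≡1ᴹ+ᴹN ⟨
    entry (J ^ᴹ r) i₀ jᵣ            ≡⟨ cong (λ A → entry A i₀ jᵣ) J^r≡1ᴹ ⟩
    entry 1ᴹ i₀ jᵣ                  ≡⟨ entry-1ᴹ-off i₀≢jᵣ ⟩
    0F p m                          ∎)
    where
    open ≡-Reasoning
    jᵣ : Fin m
    jᵣ = fromℕ< r<m
    i₀≢jᵣ : i₀ ≢ jᵣ
    i₀≢jᵣ i₀≡jᵣ = ℕ.<⇒≢ 0<r (trans (sym (toℕ-fromℕ< 0<m)) (trans (cong toℕ i₀≡jᵣ) (toℕ-fromℕ< r<m)))

  N*geom[J] : ℕ → Mat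
  N*geom[J] a = N *ᴹ geom J a

  J^a≡1ᴹ+ᴹN*geom[J] : ∀ a → J ^ᴹ a ≡ 1ᴹ +ᴹ N*geom[J] a
  J^a≡1ᴹ+ᴹN*geom[J] a = subst (λ A → A ^ᴹ a ≡ 1ᴹ +ᴹ N *ᴹ geom A a) (sym J≡1ᴹ+ᴹN) ([1+z]^k≈1+z*geom[1+z]k N a)

  N*geom[J]^m≡0ᴹ : ∀ a → N*geom[J] a ^ᴹ m ≡ 0ᴹ
  N*geom[J]^m≡0ᴹ a = begin
    (N *ᴹ geom J a) ^ᴹ m         ≡⟨ ^-distrib-* m (commute-geom a N-commutes-with-J) ⟩
    N ^ᴹ m *ᴹ geom J a ^ᴹ m      ≡⟨ cong (_*ᴹ geom J a ^ᴹ m) shiftMatrix^m≡0ᴹ ⟩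
    0ᴹ *ᴹ geom J a ^ᴹ m          ≡⟨ *ᴹ-zeroˡ (geom J a ^ᴹ m) ⟩
    0ᴹ                           ∎
    where
    open ≡-Reasoning
    N-commutes-with-J : N *ᴹ J ≡ J *ᴹ N
    N-commutes-with-J = subst (λ A → N *ᴹ A ≡ A *ᴹ N) (sym J≡1ᴹ+ᴹN) (commute-+ (commute-1 N) refl)

  kills : ∀ e → m < p ^ e → Kills p m (p ^ e)
  kills e m<p^e ((β , v) , (a , β≡J^a)) = begin
    _^ᴳ_ p m (β , v) (p ^ e)
      ≡⟨ ^ᴳ-formula β v (p ^ e) ⟩
    (β ^ᴹ (p ^ e) , geom β (p ^ e) ·ᵛ v)
      ≡⟨ cong (λ A → (A ^ᴹ (p ^ e) , geom A (p ^ e) ·ᵛ v)) β≡1ᴹ+ᴹZ ⟩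
    ((1ᴹ +ᴹ Z) ^ᴹ (p ^ e) , geom (1ᴹ +ᴹ Z) (p ^ e) ·ᵛ v)
      ≡⟨ cong₂ (λ A B → (A , B ·ᵛ v)) (U.[1+z]^p^e≈1 p-prime p×1ᴹ≡0ᴹ 0<m e (ℕ.<⇒≤ m<p^e))
                                       (U.geom[1+z]p^e≈0 p-prime p×1ᴹ≡0ᴹ 0<m e m<p^e) ⟩
    (1ᴹ , 0ᴹ ·ᵛ v)
      ≡⟨ cong (1ᴹ ,_) (0ᴹ-·ᵛ v) ⟩
    (1ᴹ , 0ᵛ) ∎
    where
    open ≡-Reasoning
    Z : Mat
    Z = N*geom[J] a
    module U = Unipotent Z m (N*geom[J]^m≡0ᴹ a)
    β≡1ᴹ+ᴹZ : β ≡ 1ᴹ +ᴹ Z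
    β≡1ᴹ+ᴹZ = trans β≡J^a (trans (matPow≡^ᴹ J a) (J^a≡1ᴹ+ᴹN*geom[J] a))

  module PrimePowerBounds (n : ℕ) (p^n<m : p ^ n < m) (m≤p^[1+n] : m ≤ p ^ suc n) where

    private
      q : ℕ
      q = p ^ suc n

    J-order : ∀ k → J ^ᴹ k ≡ 1ᴹ → q ∣ k
    J-order = ^≈1⇒p^[1+n]∣ n p-prime (J^p^e≡1ᴹ (suc n) m≤p^[1+n]) (J^r≢1ᴹ (p ^ n) (ℕ.m^n>0 p n) p^n<m)

    J-element : G p m
    J-element = (J , 0ᵛ) , (1 , sym (*ᴹ-identityˡ J))

    kills⇒p^[1+n]∣ : ∀ {k} → Kills p m k → q ∣ k
    kills⇒p^[1+n]∣ {k} K = J-order k (cong proj₁ (trans (sym (^ᴳ-formula J 0ᵛ k)) (K J-element)))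

    module _ (m≡p^[1+n] : m ≡ q) where

      last : Fin m
      last = fromℕ< (ℕ.m≤pred[n]⇒suc[m]≤n {{ℕ.>-nonZero 0<m}} ℕ.≤-refl)

      J-last-element : G p m
      J-last-element = (J , unitVector last) , (1 , sym (*ᴹ-identityˡ J))

      entry-geom[J]q : entry (geom J q) i₀ last ≡ 1F p m
      entry-geom[J]q = begin
        entry (geom J q) i₀ last                       ≡⟨ cong (λ A → entry (geom A q) i₀ last) J≡1ᴹ+ᴹN ⟩
        entry (geom (1ᴹ +ᴹ N) q) i₀ last               ≡⟨ cong (λ A → entry A i₀ last) (geom[1+z]k≈poly[kC[1+_]] 0<m q) ⟩
        entry (poly (λ j → q C suc j)) i₀ last         ≡⟨ entry-poly (λ j → q C suc j) last (toℕ-fromℕ< 0<m) ⟩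
        (q C suc (toℕ last)) ×ᶠ 1F p m                 ≡⟨ cong (λ j → (q C j) ×ᶠ 1F p m) suc-last≡q ⟩
        (q C q) ×ᶠ 1F p m                              ≡⟨ trans (cong (_×ᶠ 1F p m) (nCn≡1 q)) (n×1≡[n] 1) ⟩
        1F p m                                         ∎
        where
        open ≡-Reasoning
        suc-last≡q : suc (toℕ last) ≡ q
        suc-last≡q = trans (cong suc (toℕ-fromℕ< _)) (trans (ℕ.suc-pred m {{ℕ.>-nonZero 0<m}}) m≡p^[1+n])

      lookup-geom[J]t*q·last : ∀ t → lookup (geom J (t * q) ·ᵛ unitVector last) i₀ ≡ t ×ᶠ 1F p m
      lookup-geom[J]t*q·last t = begin
        lookup (geom J (t * q) ·ᵛ unitVector last) i₀
          ≡⟨ lookup-·ᵛ-unitVector (geom J (t * q)) i₀ last ⟩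
        entry (geom J (t * q)) i₀ last
          ≡⟨ cong (λ A → entry A i₀ last) (geom-*-period (J^p^e≡1ᴹ (suc n) m≤p^[1+n]) t) ⟩
        entry (t ×ᴹ geom J q) i₀ last
          ≡⟨ entry-× t (geom J q) i₀ last ⟩
        t ×ᶠ entry (geom J q) i₀ last
          ≡⟨ cong (t ×ᶠ_) entry-geom[J]q ⟩
        t ×ᶠ 1F p m ∎
        where open ≡-Reasoning

      kills∧q∣⇒p^[2+n]∣ : ∀ {k} → Kills p m k → q ∣ k → p ^ suc (suc n) ∣ k
      kills∧q∣⇒p^[2+n]∣ K (divides t refl) = *-monoˡ-∣ q (n×1≡0⇒p∣n {t} (begin
        t ×ᶠ 1F p m                                   ≡⟨ lookup-geom[J]t*q·last t ⟨
        lookup (geom J (t * q) ·ᵛ unitVector last) i₀ ≡⟨ cong (λ x → lookup (proj₂ x) i₀) J-last-element^[t*q]≡e ⟩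
        lookup 0ᵛ i₀                                  ≡⟨ lookup-replicate i₀ (0F p m) ⟩
        0F p m                                        ∎))
        where
        open ≡-Reasoning
        J-last-element^[t*q]≡e : (J ^ᴹ (t * q) , geom J (t * q) ·ᵛ unitVector last) ≡ (1ᴹ , 0ᵛ)
        J-last-element^[t*q]≡e = trans (sym (^ᴳ-formula J (unitVector last) (t * q))) (K J-last-element)

      kills⇒p^[2+n]∣ : ∀ {k} → Kills p m k → p ^ suc (suc n) ∣ k
      kills⇒p^[2+n]∣ K = kills∧q∣⇒p^[2+n]∣ K (kills⇒p^[1+n]∣ K)

      exponent-≡ : HasExponent p m (p ^ suc (suc n))
      exponent-≡ = hasExponent (p ^ suc (suc n)) (ℕ.m^n>0 p (suc (suc n))) (kills (suc (suc n)) m<p^[2+n])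
        (λ _ → kills⇒p^[2+n]∣)
        where
        m<p^[2+n] : m < p ^ suc (suc n)
        m<p^[2+n] = subst (_< p ^ suc (suc n)) (sym m≡p^[1+n])
          (ℕ.^-monoʳ-< p (ℕ.nonTrivial⇒n>1 p {{prime⇒nonTrivial p-prime}}) (ℕ.n<1+n (suc n)))

    exponent-< : m < q → HasExponent p m q
    exponent-< m<q = hasExponent q (ℕ.m^n>0 p (suc n)) (kills (suc n) m<q) (λ _ → kills⇒p^[1+n]∣)

    instance
      q≢0 : NonZero q
      q≢0 = ℕ.m^n≢0 p (suc n)

    order : HasOrder p m (p ^ (m + suc n))
    order = hasOrder-from-bijection bijection element element-injective element-surjective
      where
      p^[m+1+n]≡q*p^m : p ^ (m + suc n) ≡ q * p ^ m
      p^[m+1+n]≡q*p^m = trans (ℕ.^-distribˡ-+-* p m (suc n)) (ℕ.*-comm (p ^ m) q)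
      bijection : Fin (p ^ (m + suc n)) ↔ (Fin q × Vec (F p m) m)
      bijection = subst (λ N → Fin N ↔ (Fin q × Vec (F p m) m)) (sym p^[m+1+n]≡q*p^m)
        (↔-trans *↔× (×-cong ↔-refl (↔-trans (Fin[m^n]↔Fin[m]^n p m) (↔Vec m))))
      element : Fin q × Vec (F p m) m → G p m
      element (a , v) = (matPow p m J (toℕ a) , v) , (toℕ a , refl)
      element-injective : ∀ x y → raw p m (element x) ≡ raw p m (element y) → x ≡ y
      element-injective (a , v) (b , w) eq = cong₂ _,_ (toℕ-injective a≡b) (cong proj₂ eq)
        where
        a≡b : toℕ a ≡ toℕ b
        a≡b = ^-injective J-order (J^p^e≡1ᴹ (suc n) m≤p^[1+n]) (toℕ<n a) (toℕ<n b)
                (trans (sym (matPow≡^ᴹ J (toℕ a))) (trans (cong proj₁ eq) (matPow≡^ᴹ J (toℕ b))))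
      element-surjective : ∀ g → ∃[ x ] raw p m (element x) ≡ raw p m g
      element-surjective ((β , v) , (k , β≡J^k)) = (fromℕ< (m%n<n k q) , v) , cong (_, v) (begin
        matPow p m J (toℕ (fromℕ< (m%n<n k q)))   ≡⟨ cong (matPow p m J) (toℕ-fromℕ< (m%n<n k q)) ⟩
        matPow p m J (k % q)                      ≡⟨ matPow≡^ᴹ J (k % q) ⟩
        J ^ᴹ (k % q)                              ≡⟨ ^-mod q (J^p^e≡1ᴹ (suc n) m≤p^[1+n]) k ⟨
        J ^ᴹ k                                    ≡⟨ matPow≡^ᴹ J k ⟨
        matPow p m J k                            ≡⟨ β≡J^k ⟨
        β                                         ∎)
        where open ≡-Reasoning

proposition2p3 : (p : ℕ) (pr : Prime p) (m n : ℕ) → 1 ≤ m → 1 ≤ n →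
    p ^ (n ∸ 1) < m → m ≤ p ^ n →
    HasOrder p {{prime⇒nonZero pr}} m (p ^ (m + n))
    × (m < p ^ n → HasExponent p {{prime⇒nonZero pr}} m (p ^ n))
    × (m ≡ p ^ n → HasExponent p {{prime⇒nonZero pr}} m (p ^ (n + 1)))
proposition2p3 p pr m (suc n) 0<m (s≤s z≤n) p^n<m m≤p^[1+n] =
  order , exponent-< , λ m≡p^[1+n] → subst (HasExponent p m) (cong (p ^_) (ℕ.+-comm 1 (suc n))) (exponent-≡ m≡p^[1+n])
  where
  instance
    p≢0 : NonZero p
    p≢0 = prime⇒nonZero pr
  open JordanHolomorph p pr m 0<m
  open PrimePowerBounds n p^n<m m≤p^[1+n]
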